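{- Let $K$ be a field, $n\ge1$, $a\in(0,1/2)$, let $T$ be any $2^n\times2^n$ matrix over $K$ and let $M$ be a $2^n\times2^n$ matrix over $K$ of rank $r$, both with rows and columns indexed by $\{0,1\}^n$. Then there is a $2^n\times2^n$ matrix $M'$ over $K$ of rank at most $r+4\cdot n\cdot 2^{\,n-\Omega(a^2n)}$ (absolute implied constant) such that $M'(u,v)=T(u,v)$ for all $u,v\in\{0,1\}^n$ for which at least one of the following holds: $|u|\notin[(1/2-a)n,(1/2+a)n]$; $|v|\notin[(1/2-a)n,(1/2+a)n]$; or $M(u,v)=T(u,v)$.
   Context: For $v\in\{0,1\}^n$, $|v|$ denotes the number of ones in $v$.
   Formalization: The parameter a ranges over the rationals in $(0,1/2)$. -}

module Defs where

open import Level using (Level; _⊔_)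
open import Data.Nat as ℕ using (ℕ; zero; suc; _^_; _≤_)
open import Data.Integer using (+_; -[1+_])
open import Data.Fin as F using (Fin)
open import Data.Vec using (Vec; []; _∷_)
open import Data.Bool using (Bool; true; false)
open import Data.Product using (Σ; _×_)
open import Data.Rational as ℚ using (ℚ; ↥_; ↧ₙ_)
open import Relation.Nullary using (¬_)
open import Algebra.Bundles using (CommutativeRing)

record Field (c ℓ : Level) : Set (Level.suc (c ⊔ ℓ)) where
  field
    commutativeRing : CommutativeRing c ℓ
  open CommutativeRing commutativeRing public
  field
    1≉0     : ¬ (1# ≈ 0#)
    inverse : ∀ x → ¬ (x ≈ 0#) → Σ Carrier (λ y → (x * y) ≈ 1#)

weight : ∀ {n} → Vec Bool n → ℕ
weight []          = 0
weight (true ∷ v)  = suc (weight v)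
weight (false ∷ v) = weight v

Central : (n : ℕ) → ℚ → Vec Bool n → Set
Central n a u =
  ((ℚ.½ ℚ.- a) ℚ.* (+ n ℚ./ 1) ℚ.≤ (+ weight u ℚ./ 1)) ×
  ((+ weight u ℚ./ 1) ℚ.≤ (ℚ.½ ℚ.+ a) ℚ.* (+ n ℚ./ 1))

module _ {c ℓ} (K : Field c ℓ) where
  open Field K

  Matrix : ℕ → Set c
  Matrix n = Vec Bool n → Vec Bool n → Carrier

  Σᶠ : (k : ℕ) → (Fin k → Carrier) → Carrier
  Σᶠ zero    f = 0#
  Σᶠ (suc k) f = f F.zero + Σᶠ k (λ i → f (F.suc i))

  LinIndepRows : ∀ {n} → Matrix n → (k : ℕ) → (Fin k → Vec Bool n) → Set (c ⊔ ℓ)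
  LinIndepRows M k ρ =
    (coef : Fin k → Carrier) →
    (∀ v → Σᶠ k (λ i → coef i * M (ρ i) v) ≈ 0#) →
    ∀ i → coef i ≈ 0#

  HasRank : ∀ {n} → Matrix n → ℕ → Set (c ⊔ ℓ)
  HasRank {n} M r =
    Σ (Fin r → Vec Bool n) (λ ρ → LinIndepRows M r ρ) ×
    (∀ k (ρ : Fin k → Vec Bool n) → LinIndepRows M k ρ → k ≤ r)

-- Pow2Le x y e  :⟺  x ≤ y · 2^e   (x, y ∈ ℕ, e ∈ ℚ; e = p/q in lowest terms, q > 0)
Pow2Le : ℕ → ℕ → ℚ → Set
Pow2Le x y e with ↥ e
... | + p      = x ^ ↧ₙ e ≤ y ^ ↧ₙ e ℕ.* 2 ^ p
... | -[1+ p ] = x ^ ↧ₙ e ℕ.* 2 ^ suc p ≤ y ^ ↧ₙ e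

module Submission where

-- Corollary 3.1 with κ = 1/2.  Call u ∈ {0,1}^n central when
-- (1/2 - a)n ≤ |u| ≤ (1/2 + a)n, and let M′ be M on central rows and columns
-- and T elsewhere; M′ agrees with T wherever required, and its rank exceeds
-- r = rank M by at most 4n · 2^(n - a²n/2).  The rank bound combines:
--  (1) LinearAlgebra: changing a matrix only in the rows and columns listed in
--      S adds at most 2|S| independent rows.  Field equality is undecidable,
--      so the proof (dual systems of functionals, one point of S at a time)
--      runs in the double-negation monad of Classical; the conclusion is a
--      decidable inequality and so holds outright.
--  (2) CubeCounting, BinomialTail: by complementation at most 2L points are
--      non-central, L being the number below the band, and a Chernoff
--      argument (on the power inequalities of PowerInequalities) bounds L.
--  (3) RationalBookkeeping translates the band, the exponent and Pow2Le
--      between ℚ and ℕ.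

open import Defs
open import Data.Nat using (ℕ; NonZero)

module Classical where

  open import Data.Nat using (zero; suc)
  open import Data.Fin as F using (Fin)
  open import Data.Vec using (Vec; []; _∷_)
  open import Data.Bool using (Bool; true; false)
  open import Relation.Nullary using (¬_)
  open import Relation.Nullary.Negation using (¬¬-map; negated-stable)

  _>>=_ : ∀ {a b} {A : Set a} {B : Set b} → ¬ ¬ A → (A → ¬ ¬ B) → ¬ ¬ B
  x >>= f = negated-stable (¬¬-map f x)

  return : ∀ {a} {A : Set a} → A → ¬ ¬ A
  return x ¬x = ¬x x

  ¬¬-∀-Fin : ∀ {p} k {Q : Fin k → Set p} → (∀ i → ¬ ¬ Q i) → ¬ ¬ (∀ i → Q i)
  ¬¬-∀-Fin zero    h = return (λ ())
  ¬¬-∀-Fin (suc k) h = do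
    q₀ ← h F.zero
    qs ← ¬¬-∀-Fin k (λ i → h (F.suc i))
    return λ { F.zero → q₀ ; (F.suc i) → qs i }

  ¬¬-∀-cube : ∀ {p} m {Q : Vec Bool m → Set p} → (∀ v → ¬ ¬ Q v) → ¬ ¬ (∀ v → Q v)
  ¬¬-∀-cube zero    h = do
    q ← h []
    return λ { [] → q }
  ¬¬-∀-cube (suc m) h = do
    qt ← ¬¬-∀-cube m (λ v → h (true ∷ v))
    qf ← ¬¬-∀-cube m (λ v → h (false ∷ v))
    return λ { (true ∷ v) → qt v ; (false ∷ v) → qf v }

module LinearAlgebra {c ℓ} (K : Field c ℓ) where

  open import Level using (_⊔_)
  open import Data.Nat as ℕ using (ℕ; zero; suc)
  open import Data.Fin as F using (Fin; punchIn)
  open import Data.Fin.Properties using (punchInᵢ≢i)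
  open import Data.Vec using (Vec; []; _∷_)
  open import Data.Bool using (Bool; true; false)
  open import Data.Product using (Σ; _×_; _,_; proj₁; proj₂)
  open import Data.Empty using (⊥-elim)
  open import Relation.Nullary using (¬_; yes; no)
  open import Relation.Nullary.Negation using (¬¬-map)
  open import Relation.Nullary.Decidable using (¬¬-excluded-middle; decidable-stable)
  open import Relation.Binary.PropositionalEquality as P using (_≡_; _≢_)
  open import Relation.Binary.Definitions using (DecidableEquality)
  open import Data.List using (List; []; _∷_; length)
  open import Data.List.Relation.Unary.Any using (here; there)
  import Data.List.Membership.DecPropositional as DecMembership
  import Data.Nat.Properties as NP
  import Data.Vec.Properties as VecP
  import Data.Bool.Properties as BoolP
  open import Data.Fin.Properties using (any?)
  open Classical

  open Field K hiding (zero)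
  open import Algebra.Properties.Ring ring using (-0#≈0#; -‿distribˡ-*; -‿+-comm; [y-z]x≈yx-zx)
  open import Algebra.Properties.CommutativeSemigroup +-commutativeSemigroup using (interchange)
  open import Relation.Binary.Reasoning.Setoid setoid

  x-0≈x : ∀ x → x - 0# ≈ x
  x-0≈x x = trans (+-congˡ -0#≈0#) (+-identityʳ x)

  Σᶠ-cong : ∀ k {f g : Fin k → Carrier} → (∀ i → f i ≈ g i) → Σᶠ K k f ≈ Σᶠ K k g
  Σᶠ-cong zero    h = refl
  Σᶠ-cong (suc k) h = +-cong (h F.zero) (Σᶠ-cong k (λ i → h (F.suc i)))

  Σᶠ-zero : ∀ k {f : Fin k → Carrier} → (∀ i → f i ≈ 0#) → Σᶠ K k f ≈ 0#
  Σᶠ-zero zero    h = refl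
  Σᶠ-zero (suc k) h = trans (+-cong (h F.zero) (Σᶠ-zero k (λ i → h (F.suc i)))) (+-identityʳ 0#)

  Σᶠ-+ : ∀ k (f g : Fin k → Carrier) → Σᶠ K k (λ i → f i + g i) ≈ Σᶠ K k f + Σᶠ K k g
  Σᶠ-+ zero    f g = sym (+-identityʳ 0#)
  Σᶠ-+ (suc k) f g = trans (+-congˡ (Σᶠ-+ k (λ i → f (F.suc i)) (λ i → g (F.suc i))))
                           (interchange (f F.zero) (g F.zero) _ _)

  Σᶠ-*ˡ : ∀ k α (f : Fin k → Carrier) → Σᶠ K k (λ i → α * f i) ≈ α * Σᶠ K k f
  Σᶠ-*ˡ zero    α f = sym (zeroʳ α)
  Σᶠ-*ˡ (suc k) α f = trans (+-congˡ (Σᶠ-*ˡ k α (λ i → f (F.suc i)))) (sym (distribˡ α _ _))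

  Σᶠ-neg : ∀ k (f : Fin k → Carrier) → Σᶠ K k (λ i → - f i) ≈ - Σᶠ K k f
  Σᶠ-neg zero    f = sym -0#≈0#
  Σᶠ-neg (suc k) f = trans (+-congˡ (Σᶠ-neg k (λ i → f (F.suc i)))) (-‿+-comm _ _)

  δ : ∀ {k} → Fin k → Fin k → Carrier
  δ F.zero    F.zero    = 1#
  δ F.zero    (F.suc _) = 0#
  δ (F.suc _) F.zero    = 0#
  δ (F.suc a) (F.suc b) = δ a b

  δ-refl : ∀ {k} (a : Fin k) → δ a a ≈ 1#
  δ-refl F.zero    = refl
  δ-refl (F.suc a) = δ-refl a

  δ-≢ : ∀ {k} (a b : Fin k) → a ≢ b → δ a b ≈ 0#
  δ-≢ F.zero    F.zero    a≢b = ⊥-elim (a≢b P.refl)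
  δ-≢ F.zero    (F.suc b) a≢b = refl
  δ-≢ (F.suc a) F.zero    a≢b = refl
  δ-≢ (F.suc a) (F.suc b) a≢b = δ-≢ a b (λ a≡b → a≢b (P.cong F.suc a≡b))

  δ-sym : ∀ {k} (a b : Fin k) → δ a b ≡ δ b a
  δ-sym F.zero    F.zero    = P.refl
  δ-sym F.zero    (F.suc b) = P.refl
  δ-sym (F.suc a) F.zero    = P.refl
  δ-sym (F.suc a) (F.suc b) = δ-sym a b

  δ-punchIn : ∀ {k} (i : Fin (suc k)) (a b : Fin k) → δ (punchIn i a) (punchIn i b) ≡ δ a b
  δ-punchIn F.zero    a         b         = P.refl
  δ-punchIn (F.suc i) F.zero    F.zero    = P.refl
  δ-punchIn (F.suc i) F.zero    (F.suc b) = P.refl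
  δ-punchIn (F.suc i) (F.suc a) F.zero    = P.refl
  δ-punchIn (F.suc i) (F.suc a) (F.suc b) = δ-punchIn i a b

  Σᶠ-δ : ∀ k (f : Fin k → Carrier) (b : Fin k) → Σᶠ K k (λ a → f a * δ a b) ≈ f b
  Σᶠ-δ (suc k) f F.zero = begin
    f F.zero * 1# + Σᶠ K k (λ a → f (F.suc a) * 0#)  ≈⟨ +-cong (*-identityʳ _) (Σᶠ-zero k (λ a → zeroʳ _)) ⟩
    f F.zero + 0#                                      ≈⟨ +-identityʳ _ ⟩
    f F.zero                                           ∎
  Σᶠ-δ (suc k) f (F.suc b) = begin
    f F.zero * 0# + Σᶠ K k (λ a → f (F.suc a) * δ a b)  ≈⟨ +-cong (zeroʳ _) (Σᶠ-δ k (λ a → f (F.suc a)) b) ⟩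
    0# + f (F.suc b)                                      ≈⟨ +-identityˡ _ ⟩
    f (F.suc b)                                           ∎

  Σᶜ : (m : ℕ) → (Vec Bool m → Carrier) → Carrier
  Σᶜ zero    f = f []
  Σᶜ (suc m) f = Σᶜ m (λ v → f (true ∷ v)) + Σᶜ m (λ v → f (false ∷ v))

  Σᶜ-cong : ∀ m {f g : Vec Bool m → Carrier} → (∀ v → f v ≈ g v) → Σᶜ m f ≈ Σᶜ m g
  Σᶜ-cong zero    h = h []
  Σᶜ-cong (suc m) h = +-cong (Σᶜ-cong m (λ v → h (true ∷ v))) (Σᶜ-cong m (λ v → h (false ∷ v)))

  Σᶜ-zero : ∀ m {f : Vec Bool m → Carrier} → (∀ v → f v ≈ 0#) → Σᶜ m f ≈ 0#
  Σᶜ-zero zero    h = h []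
  Σᶜ-zero (suc m) h = trans (+-cong (Σᶜ-zero m (λ v → h (true ∷ v))) (Σᶜ-zero m (λ v → h (false ∷ v))))
                            (+-identityʳ 0#)

  Σᶜ-+ : ∀ m (f g : Vec Bool m → Carrier) → Σᶜ m (λ v → f v + g v) ≈ Σᶜ m f + Σᶜ m g
  Σᶜ-+ zero    f g = refl
  Σᶜ-+ (suc m) f g = trans (+-cong (Σᶜ-+ m _ _) (Σᶜ-+ m _ _)) (interchange _ _ _ _)

  Σᶜ-*ˡ : ∀ m α (f : Vec Bool m → Carrier) → Σᶜ m (λ v → α * f v) ≈ α * Σᶜ m f
  Σᶜ-*ˡ zero    α f = refl
  Σᶜ-*ˡ (suc m) α f = trans (+-cong (Σᶜ-*ˡ m α _) (Σᶜ-*ˡ m α _)) (sym (distribˡ α _ _))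

  Σᶜ-neg : ∀ m (f : Vec Bool m → Carrier) → Σᶜ m (λ v → - f v) ≈ - Σᶜ m f
  Σᶜ-neg zero    f = refl
  Σᶜ-neg (suc m) f = trans (+-cong (Σᶜ-neg m _) (Σᶜ-neg m _)) (-‿+-comm _ _)

  Σᶜ-Σᶠ : ∀ m k (F : Fin k → Vec Bool m → Carrier) →
          Σᶜ m (λ v → Σᶠ K k (λ a → F a v)) ≈ Σᶠ K k (λ a → Σᶜ m (F a))
  Σᶜ-Σᶠ zero    k F = refl
  Σᶜ-Σᶠ (suc m) k F = begin
    Σᶜ m (λ v → Σᶠ K k (λ a → F a (true ∷ v))) + Σᶜ m (λ v → Σᶠ K k (λ a → F a (false ∷ v)))
      ≈⟨ +-cong (Σᶜ-Σᶠ m k _) (Σᶜ-Σᶠ m k _) ⟩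
    Σᶠ K k (λ a → Σᶜ m (λ v → F a (true ∷ v))) + Σᶠ K k (λ a → Σᶜ m (λ v → F a (false ∷ v)))
      ≈⟨ sym (Σᶠ-+ k _ _) ⟩
    Σᶠ K k (λ a → Σᶜ (suc m) (F a))  ∎

  point : ∀ {m} → Vec Bool m → Vec Bool m → Carrier
  point []         []          = 1#
  point (true ∷ v)  (true ∷ u)  = point v u
  point (true ∷ v)  (false ∷ u) = 0#
  point (false ∷ v) (true ∷ u)  = 0#
  point (false ∷ v) (false ∷ u) = point v u

  Σᶜ-point : ∀ m (v : Vec Bool m) (x : Vec Bool m → Carrier) → Σᶜ m (λ u → point v u * x u) ≈ x v
  Σᶜ-point zero    []          x = *-identityˡ _
  Σᶜ-point (suc m) (true ∷ v)  x = begin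
    Σᶜ m (λ u → point v u * x (true ∷ u)) + Σᶜ m (λ u → 0# * x (false ∷ u))
      ≈⟨ +-cong (Σᶜ-point m v _) (Σᶜ-zero m (λ u → zeroˡ _)) ⟩
    x (true ∷ v) + 0#  ≈⟨ +-identityʳ _ ⟩
    x (true ∷ v)       ∎
  Σᶜ-point (suc m) (false ∷ v) x = begin
    Σᶜ m (λ u → 0# * x (true ∷ u)) + Σᶜ m (λ u → point v u * x (false ∷ u))
      ≈⟨ +-cong (Σᶜ-zero m (λ u → zeroˡ _)) (Σᶜ-point m v _) ⟩
    0# + x (false ∷ v)  ≈⟨ +-identityˡ _ ⟩
    x (false ∷ v)       ∎

  -- Linear algebra in K^({0,1}^n).  A function φ on the cube acts on vectors
  -- as the linear functional x ↦ ⟪ φ , x ⟫.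
  module Duality (n : ℕ) where

    open Classical

    Cube : Set
    Cube = Vec Bool n

    Vector : Set c
    Vector = Cube → Carrier

    ⟪_,_⟫ : Vector → Vector → Carrier
    ⟪ f , x ⟫ = Σᶜ n (λ v → f v * x v)

    ⟪⟫-comm : ∀ f x → ⟪ f , x ⟫ ≈ ⟪ x , f ⟫
    ⟪⟫-comm f x = Σᶜ-cong n (λ v → *-comm (f v) (x v))

    ⟪⟫-zeroʳ : ∀ f {x : Vector} → (∀ v → x v ≈ 0#) → ⟪ f , x ⟫ ≈ 0#
    ⟪⟫-zeroʳ f h = Σᶜ-zero n (λ v → trans (*-congˡ (h v)) (zeroʳ _))

    ⟪⟫-*ˡ : ∀ α f x → ⟪ (λ u → α * f u) , x ⟫ ≈ α * ⟪ f , x ⟫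
    ⟪⟫-*ˡ α f x = trans (Σᶜ-cong n (λ v → *-assoc α (f v) (x v))) (Σᶜ-*ˡ n α _)

    ⟪⟫--ˡ : ∀ f g x → ⟪ (λ u → f u - g u) , x ⟫ ≈ ⟪ f , x ⟫ - ⟪ g , x ⟫
    ⟪⟫--ˡ f g x = begin
      Σᶜ n (λ v → (f v - g v) * x v)          ≈⟨ Σᶜ-cong n (λ v → [y-z]x≈yx-zx (x v) (f v) (g v)) ⟩
      Σᶜ n (λ v → f v * x v - g v * x v)      ≈⟨ Σᶜ-+ n _ _ ⟩
      ⟪ f , x ⟫ + Σᶜ n (λ v → - (g v * x v))  ≈⟨ +-congˡ (Σᶜ-neg n _) ⟩
      ⟪ f , x ⟫ - ⟪ g , x ⟫                   ∎

    ⟪⟫-linearˡ : ∀ α f g x → ⟪ (λ u → f u - α * g u) , x ⟫ ≈ ⟪ f , x ⟫ - α * ⟪ g , x ⟫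
    ⟪⟫-linearˡ α f g x = trans (⟪⟫--ˡ f (λ u → α * g u) x) (+-congˡ (-‿cong (⟪⟫-*ˡ α g x)))

    ⟪⟫-Σˡ : ∀ k (c : Fin k → Carrier) (φ : Fin k → Vector) x →
            ⟪ (λ u → Σᶠ K k (λ a → c a * φ a u)) , x ⟫ ≈ Σᶠ K k (λ a → c a * ⟪ φ a , x ⟫)
    ⟪⟫-Σˡ k c φ x = begin
      Σᶜ n (λ v → Σᶠ K k (λ a → c a * φ a v) * x v)
        ≈⟨ Σᶜ-cong n (λ v → trans (*-comm _ (x v)) (sym (Σᶠ-*ˡ k (x v) _))) ⟩
      Σᶜ n (λ v → Σᶠ K k (λ a → x v * (c a * φ a v)))
        ≈⟨ Σᶜ-Σᶠ n k _ ⟩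
      Σᶠ K k (λ a → Σᶜ n (λ v → x v * (c a * φ a v)))
        ≈⟨ Σᶠ-cong k (λ a → trans (Σᶜ-cong n (λ v → trans (*-comm (x v) _) (*-assoc (c a) (φ a v) (x v))))
                                  (Σᶜ-*ˡ n (c a) _)) ⟩
      Σᶠ K k (λ a → c a * ⟪ φ a , x ⟫)  ∎

    ⟪⟫-Σʳ : ∀ k (c : Fin k → Carrier) f (x : Fin k → Vector) →
            ⟪ f , (λ v → Σᶠ K k (λ b → c b * x b v)) ⟫ ≈ Σᶠ K k (λ b → c b * ⟪ f , x b ⟫)
    ⟪⟫-Σʳ k c f x = trans (⟪⟫-comm f _)
      (trans (⟪⟫-Σˡ k c x f) (Σᶠ-cong k (λ b → *-congˡ (⟪⟫-comm (x b) f))))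

    Independent : (k : ℕ) → (Fin k → Vector) → Set (c ⊔ ℓ)
    Independent k w = (coef : Fin k → Carrier) →
      (∀ v → Σᶠ K k (λ i → coef i * w i v) ≈ 0#) → ∀ i → coef i ≈ 0#

    Biorthogonal : (k : ℕ) → (Fin k → Vector) → (Fin k → Vector) → Set ℓ
    Biorthogonal k φ w = ∀ a b → ⟪ φ a , w b ⟫ ≈ δ a b

    DualSystem : (k : ℕ) → (Fin k → Vector) → Set (c ⊔ ℓ)
    DualSystem k w = Σ (Fin k → Vector) (λ φ → Biorthogonal k φ w)

    independent-tail : ∀ k (w : Fin (suc k) → Vector) → Independent (suc k) w →
                       Independent k (λ b → w (F.suc b))
    independent-tail k w ind coef rel i =
      ind (λ { F.zero → 0# ; (F.suc a) → coef a })
          (λ v → trans (+-cong (zeroˡ _) (rel v)) (+-identityʳ 0#)) (F.suc i)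

    extend-dual : ∀ k (w : Fin (suc k) → Vector) (φ′ : Fin k → Vector) (φ₀ : Vector) →
      Biorthogonal k φ′ (λ b → w (F.suc b)) →
      ⟪ φ₀ , w F.zero ⟫ ≈ 1# → (∀ b → ⟪ φ₀ , w (F.suc b) ⟫ ≈ 0#) → DualSystem (suc k) w
    extend-dual k w φ′ φ₀ dual′ one zeros = φ , dual
      where
      φ : Fin (suc k) → Vector
      φ F.zero    = φ₀
      φ (F.suc a) u = φ′ a u - ⟪ φ′ a , w F.zero ⟫ * φ₀ u
      dual : Biorthogonal (suc k) φ w
      dual F.zero    F.zero    = one
      dual F.zero    (F.suc b) = zeros b
      dual (F.suc a) F.zero    = begin
        ⟪ φ (F.suc a) , w F.zero ⟫                                     ≈⟨ ⟪⟫-linearˡ _ (φ′ a) φ₀ (w F.zero) ⟩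
        ⟪ φ′ a , w F.zero ⟫ - ⟪ φ′ a , w F.zero ⟫ * ⟪ φ₀ , w F.zero ⟫  ≈⟨ +-congˡ (-‿cong (trans (*-congˡ one) (*-identityʳ _))) ⟩
        ⟪ φ′ a , w F.zero ⟫ - ⟪ φ′ a , w F.zero ⟫                      ≈⟨ -‿inverseʳ _ ⟩
        0#                                                             ∎
      dual (F.suc a) (F.suc b) = begin
        ⟪ φ (F.suc a) , w (F.suc b) ⟫                                  ≈⟨ ⟪⟫-linearˡ _ (φ′ a) φ₀ (w (F.suc b)) ⟩
        ⟪ φ′ a , w (F.suc b) ⟫ - ⟪ φ′ a , w F.zero ⟫ * ⟪ φ₀ , w (F.suc b) ⟫
                                                                       ≈⟨ +-cong (dual′ a b) (-‿cong (trans (*-congˡ (zeros b)) (zeroʳ _))) ⟩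
        δ a b - 0#                                                     ≈⟨ x-0≈x _ ⟩
        δ a b                                                          ∎

    module _ (k : ℕ) (w : Fin (suc k) → Vector) (φ′ : Fin k → Vector)
             (dual′ : Biorthogonal k φ′ (λ b → w (F.suc b))) where

      residual : Vector
      residual v = w F.zero v - Σᶠ K k (λ a → ⟪ φ′ a , w F.zero ⟫ * w (F.suc a) v)

      residual-coef : Fin (suc k) → Carrier
      residual-coef F.zero    = 1#
      residual-coef (F.suc a) = - ⟪ φ′ a , w F.zero ⟫

      residual-combination : ∀ v → Σᶠ K (suc k) (λ i → residual-coef i * w i v) ≈ residual v
      residual-combination v = +-cong (*-identityˡ _)
        (trans (Σᶠ-cong k (λ a → sym (-‿distribˡ-* _ _))) (Σᶠ-neg k _))

      -- If the residual is nonzero at v₀, the evaluation at v₀ corrected by φ′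
      -- and rescaled separates w₀ from w₁,…,w_k.
      separating : ∀ v₀ → ¬ (residual v₀ ≈ 0#) →
        Σ Vector (λ φ₀ → (⟪ φ₀ , w F.zero ⟫ ≈ 1#) × (∀ b → ⟪ φ₀ , w (F.suc b) ⟫ ≈ 0#))
      separating v₀ r≉0 = φ₀ , one , zeros
        where
        y : Carrier
        y = proj₁ (inverse (residual v₀) r≉0)
        ψ : Vector
        ψ u = point v₀ u - Σᶠ K k (λ a → w (F.suc a) v₀ * φ′ a u)
        ⟪ψ⟫ : ∀ x → ⟪ ψ , x ⟫ ≈ x v₀ - Σᶠ K k (λ a → w (F.suc a) v₀ * ⟪ φ′ a , x ⟫)
        ⟪ψ⟫ x = trans (⟪⟫--ˡ (point v₀) _ x) (+-cong (Σᶜ-point n v₀ x) (-‿cong (⟪⟫-Σˡ k _ φ′ x)))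
        ψ-w₀ : ⟪ ψ , w F.zero ⟫ ≈ residual v₀
        ψ-w₀ = trans (⟪ψ⟫ (w F.zero)) (+-congˡ (-‿cong (Σᶠ-cong k (λ a → *-comm _ _))))
        ψ-w : ∀ b → ⟪ ψ , w (F.suc b) ⟫ ≈ 0#
        ψ-w b = trans (⟪ψ⟫ (w (F.suc b)))
          (trans (+-congˡ (-‿cong (trans (Σᶠ-cong k (λ a → *-congˡ (dual′ a b))) (Σᶠ-δ k _ b))))
                 (-‿inverseʳ _))
        φ₀ : Vector
        φ₀ u = y * ψ u
        one : ⟪ φ₀ , w F.zero ⟫ ≈ 1#
        one = trans (⟪⟫-*ˡ y ψ _) (trans (*-congˡ ψ-w₀) (trans (*-comm _ _) (proj₂ (inverse _ r≉0))))
        zeros : ∀ b → ⟪ φ₀ , w (F.suc b) ⟫ ≈ 0#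
        zeros b = trans (⟪⟫-*ˡ y ψ _) (trans (*-congˡ (ψ-w b)) (zeroʳ y))

    -- Induction on
    -- k: a dual system of w₁,…,w_k leaves a residual of w₀, which is nonzero
    -- somewhere by independence, and evaluation there separates w₀.
    dual-basis : ∀ k (w : Fin k → Vector) → Independent k w → ¬ ¬ DualSystem k w
    dual-basis zero    w ind = return ((λ ()) , (λ ()))
    dual-basis (suc k) w ind = do
      (φ′ , dual′) ← dual-basis k (λ b → w (F.suc b)) (independent-tail k w ind)
      yes (v₀ , r≉0) ← ¬¬-excluded-middle {A = Σ Cube (λ v → ¬ (residual k w φ′ dual′ v ≈ 0#))}
        where no none → do
          r≈0 ← ¬¬-∀-cube n (λ v r≉0 → none (v , r≉0))
          ⊥-elim (1≉0 (ind (residual-coef k w φ′ dual′)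
                           (λ v → trans (residual-combination k w φ′ dual′ v) (r≈0 v)) F.zero))
      let (φ₀ , one , zeros) = separating k w φ′ dual′ v₀ r≉0
      return (extend-dual k w φ′ φ₀ dual′ one zeros)

    dual-punch : ∀ j (φ w : Fin (suc j) → Vector) → Biorthogonal (suc j) φ w → ∀ a₀ →
                 Biorthogonal j (λ a → φ (punchIn a₀ a)) (λ b → w (punchIn a₀ b))
    dual-punch j φ w dual a₀ a b = trans (dual (punchIn a₀ a) (punchIn a₀ b)) (reflexive (δ-punchIn a₀ a b))

    dual-injective : ∀ j (φ w : Fin j → Vector) → Biorthogonal j φ w → ∀ a b → w a ≡ w b → a ≡ b
    dual-injective j φ w dual a b wa≡wb with a F.≟ b
    ... | yes a≡b = a≡b
    ... | no  a≢b = ⊥-elim (1≉0 (begin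
      1#              ≈⟨ sym (δ-refl a) ⟩
      δ a a           ≈⟨ sym (dual a a) ⟩
      ⟪ φ a , w a ⟫   ≡⟨ P.cong (λ x → ⟪ φ a , x ⟫) wa≡wb ⟩
      ⟪ φ a , w b ⟫   ≈⟨ dual a b ⟩
      δ a b           ≈⟨ δ-≢ a b a≢b ⟩
      0#              ∎))

    -- Gaussian elimination at a coordinate d: if φ a₀ does not vanish at d,
    -- subtracting multiples of φ a₀ from the other functionals makes them
    -- vanish at d, and they stay dual to the vectors other than w a₀.
    module Eliminate (j : ℕ) (φ w : Fin (suc j) → Vector) (dual : Biorthogonal (suc j) φ w)
                     (a₀ : Fin (suc j)) (d : Cube) (φ₀d≉0 : ¬ (φ a₀ d ≈ 0#)) where

      y : Carrier
      y = proj₁ (inverse (φ a₀ d) φ₀d≉0)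

      φ′ : Fin j → Vector
      φ′ a u = φ (punchIn a₀ a) u - (φ (punchIn a₀ a) d * y) * φ a₀ u

      φ′-dual : Biorthogonal j φ′ (λ b → w (punchIn a₀ b))
      φ′-dual a b = begin
        ⟪ φ′ a , w (punchIn a₀ b) ⟫
          ≈⟨ ⟪⟫-linearˡ _ (φ (punchIn a₀ a)) (φ a₀) _ ⟩
        ⟪ φ (punchIn a₀ a) , w (punchIn a₀ b) ⟫ - (φ (punchIn a₀ a) d * y) * ⟪ φ a₀ , w (punchIn a₀ b) ⟫
          ≈⟨ +-cong (dual-punch j φ w dual a₀ a b)
                    (-‿cong (trans (*-congˡ (trans (dual a₀ _) (δ-≢ a₀ _ (λ eq → punchInᵢ≢i a₀ b (P.sym eq)))))
                                   (zeroʳ _))) ⟩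
        δ a b - 0#  ≈⟨ x-0≈x _ ⟩
        δ a b       ∎

      φ′-vanishes-at-d : ∀ a → φ′ a d ≈ 0#
      φ′-vanishes-at-d a = begin
        φ (punchIn a₀ a) d - (φ (punchIn a₀ a) d * y) * φ a₀ d
          ≈⟨ +-congˡ (-‿cong (trans (*-assoc _ y _) (trans (*-congˡ (*-comm y _)) (*-congˡ (proj₂ (inverse _ φ₀d≉0)))))) ⟩
        φ (punchIn a₀ a) d - φ (punchIn a₀ a) d * 1#  ≈⟨ +-congˡ (-‿cong (*-identityʳ _)) ⟩
        φ (punchIn a₀ a) d - φ (punchIn a₀ a) d       ≈⟨ -‿inverseʳ _ ⟩
        0#                                            ∎

      φ′-vanishes : ∀ a x → φ (punchIn a₀ a) x ≈ 0# → φ a₀ x ≈ 0# → φ′ a x ≈ 0#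
      φ′-vanishes a x h₁ h₀ = trans (+-cong h₁ (-‿cong (trans (*-congˡ h₀) (zeroʳ _)))) (x-0≈x 0#)

    _≟ᶜ_ : DecidableEquality Cube
    _≟ᶜ_ = VecP.≡-dec BoolP._≟_

    open DecMembership _≟ᶜ_ using (_∈_; _∉_; _∈?_)

    -- Reduction of k independent rows ρ of M′ along a list of points: each
    -- point costs at most one row (if it labels one of the chosen rows) and one
    -- functional (to make the dual system vanish in that column).
    module Perturbation (M′ : Cube → Cube → Carrier) (k : ℕ) (ρ : Fin k → Cube) where

      w : Fin k → Vector
      w i = M′ (ρ i)

      record Reduced (R C : List Cube) (j : ℕ) : Set (c ⊔ ℓ) where
        field
          σ           : Fin j → Fin k
          φ           : Fin j → Vector
          dual        : Biorthogonal j φ (λ a → w (σ a))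
          rows-avoid  : ∀ a → ρ (σ a) ∉ R
          cols-vanish : ∀ a {x} → x ∈ C → φ a x ≈ 0#
          size        : k ℕ.≤ j ℕ.+ (length R ℕ.+ length C)

      initial : Independent k w → ¬ ¬ Reduced [] [] k
      initial ind = do
        (φ , dual) ← dual-basis k w ind
        return record { σ = λ a → a ; φ = φ ; dual = dual ; rows-avoid = λ a () ; cols-vanish = λ a ()
                      ; size = NP.m≤m+n k 0 }

      keep-row : ∀ {R C j} d (red : Reduced R C j) → (∀ a → ρ (Reduced.σ red a) ≢ d) → Reduced (d ∷ R) C j
      keep-row {R} {C} {j} d red ρ≢d = record
        { σ = σ ; φ = φ ; dual = dual ; cols-vanish = cols-vanish
        ; rows-avoid = λ a → λ { (here eq) → ρ≢d a eq ; (there ∈R) → rows-avoid a ∈R }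
        ; size = NP.≤-trans size (NP.+-monoʳ-≤ j (NP.n≤1+n _)) }
        where open Reduced red

      -- Rows of a dual system are distinct, so removing the one labelled d
      -- leaves no row labelled d.
      remove-row : ∀ {R C j} d (red : Reduced R C (suc j)) a₀ → ρ (Reduced.σ red a₀) ≡ d → Reduced (d ∷ R) C j
      remove-row {R} {C} {j} d red a₀ ρa₀≡d = record
        { σ = λ a → σ (punchIn a₀ a)
        ; φ = λ a → φ (punchIn a₀ a)
        ; dual = dual-punch j φ _ dual a₀
        ; rows-avoid = λ a → λ
            { (here ρa≡d) → punchInᵢ≢i a₀ a
                (dual-injective _ φ _ dual _ _ (P.cong M′ (P.trans ρa≡d (P.sym ρa₀≡d))))
            ; (there ∈R) → rows-avoid _ ∈R }
        ; cols-vanish = λ a → cols-vanish (punchIn a₀ a)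
        ; size = NP.≤-trans size (NP.≤-reflexive (P.sym (NP.+-suc j _))) }
        where open Reduced red

      drop-row : ∀ {R C j} d → Reduced R C j → Σ ℕ (Reduced (d ∷ R) C)
      drop-row {j = zero} d red = zero , keep-row d red (λ ())
      drop-row {j = suc j} d red with any? (λ a → ρ (Reduced.σ red a) ≟ᶜ d)
      ... | yes (a₀ , ρa₀≡d) = j , remove-row d red a₀ ρa₀≡d
      ... | no  none         = suc j , keep-row d red (λ a ρa≡d → none (a , ρa≡d))

      keep-col : ∀ {R C j} d (red : Reduced R C j) → (∀ a → Reduced.φ red a d ≈ 0#) → Reduced R (d ∷ C) j
      keep-col {R} {C} {j} d red φd≈0 = record
        { σ = σ ; φ = φ ; dual = dual ; rows-avoid = rows-avoid
        ; cols-vanish = λ a → λ { (here P.refl) → φd≈0 a ; (there ∈C) → cols-vanish a ∈C }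
        ; size = NP.≤-trans size (NP.+-monoʳ-≤ j (NP.+-monoʳ-≤ (length R) (NP.n≤1+n _))) }
        where open Reduced red

      eliminate-col : ∀ {R C j} d (red : Reduced R C (suc j)) a₀ → ¬ (Reduced.φ red a₀ d ≈ 0#) →
                      Reduced R (d ∷ C) j
      eliminate-col {R} {C} {j} d red a₀ φa₀d≉0 = record
        { σ = λ a → σ (punchIn a₀ a)
        ; φ = φ′
        ; dual = φ′-dual
        ; rows-avoid = λ a → rows-avoid (punchIn a₀ a)
        ; cols-vanish = λ a → λ
            { (here P.refl) → φ′-vanishes-at-d a
            ; (there ∈C) → φ′-vanishes a _ (cols-vanish _ ∈C) (cols-vanish a₀ ∈C) }
        ; size = NP.≤-trans size (NP.≤-reflexive
            (P.trans (P.sym (NP.+-suc j _)) (P.cong (j ℕ.+_) (P.sym (NP.+-suc (length R) (length C)))))) }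
        where
        open Reduced red
        open Eliminate j φ (λ a → w (σ a)) dual a₀ d φa₀d≉0

      kill-column : ∀ {R C j} d → Reduced R C j → ¬ ¬ Σ ℕ (Reduced R (d ∷ C))
      kill-column {j = zero}  d red = return (zero , keep-col d red (λ ()))
      kill-column {j = suc j} d red = do
        yes (a₀ , φa₀d≉0) ← ¬¬-excluded-middle {A = Σ (Fin (suc j)) (λ a → ¬ (Reduced.φ red a d ≈ 0#))}
          where no none → ¬¬-map (λ φd≈0 → suc j , keep-col d red φd≈0)
                                 (¬¬-∀-Fin (suc j) (λ a φad≉0 → none (a , φad≉0)))
        return (j , eliminate-col d red a₀ φa₀d≉0)

      reduce : Independent k w → ∀ S → ¬ ¬ Σ ℕ (Reduced S S)
      reduce ind []      = ¬¬-map (k ,_) (initial ind)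
      reduce ind (d ∷ S) = do
        (_ , red) ← reduce ind S
        let (_ , red′) = drop-row d red
        kill-column d red′

      -- If M′ agrees with M off the rows and columns in S, the rows of a fully
      -- reduced system are independent rows of M: pairing with φ a reads off
      -- the a-th coefficient of any relation.
      reduced-independent : ∀ (M : Cube → Cube → Carrier) S {j} (red : Reduced S S j) →
        (∀ u v → u ∉ S → v ∉ S → M′ u v ≈ M u v) → Independent j (λ a → M (ρ (Reduced.σ red a)))
      reduced-independent M S {j} red agree coef rel a = begin
        coef a                                                ≈⟨ sym (Σᶠ-δ j coef a) ⟩
        Σᶠ K j (λ b → coef b * δ b a)                         ≈⟨ Σᶠ-cong j (λ b → reflexive (P.cong (coef b *_) (δ-sym b a))) ⟩
        Σᶠ K j (λ b → coef b * δ a b)                         ≈⟨ Σᶠ-cong j (λ b → *-congˡ (sym (dual a b))) ⟩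
        Σᶠ K j (λ b → coef b * ⟪ φ a , w (σ b) ⟫)             ≈⟨ Σᶠ-cong j (λ b → *-congˡ (same-pairing b)) ⟩
        Σᶠ K j (λ b → coef b * ⟪ φ a , M (ρ (σ b)) ⟫)         ≈⟨ sym (⟪⟫-Σʳ j coef (φ a) _) ⟩
        ⟪ φ a , (λ v → Σᶠ K j (λ b → coef b * M (ρ (σ b)) v)) ⟫ ≈⟨ ⟪⟫-zeroʳ (φ a) rel ⟩
        0#                                                    ∎
        where
        open Reduced red
        same-pairing : ∀ b → ⟪ φ a , w (σ b) ⟫ ≈ ⟪ φ a , M (ρ (σ b)) ⟫
        same-pairing b = Σᶜ-cong n pointwise
          where
          pointwise : ∀ v → φ a v * M′ (ρ (σ b)) v ≈ φ a v * M (ρ (σ b)) v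
          pointwise v with v ∈? S
          ... | yes v∈S = trans (*-congʳ (cols-vanish a v∈S))
                                (trans (zeroˡ _) (sym (trans (*-congʳ (cols-vanish a v∈S)) (zeroˡ _))))
          ... | no  v∉S = *-congˡ (agree _ v (rows-avoid b) v∉S)

    rank-perturbation : ∀ (M M′ : Matrix K n) (S : List Cube) →
      (∀ u v → u ∉ S → v ∉ S → M′ u v ≈ M u v) →
      ∀ r → (∀ j ρ → LinIndepRows K M j ρ → j ℕ.≤ r) →
      ∀ k ρ → LinIndepRows K M′ k ρ → k ℕ.≤ r ℕ.+ (length S ℕ.+ length S)
    rank-perturbation M M′ S agree r maxM k ρ ind = decidable-stable (k NP.≤? _) (do
        (j , red) ← reduce ind S
        return (NP.≤-trans (Reduced.size red)
                           (NP.+-monoˡ-≤ _ (maxM j _ (reduced-independent M S red agree)))))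
      where open Perturbation M′ k ρ

module PowerInequalities where

  open import Data.Nat
  open import Data.Nat.Properties
  open import Data.Nat.Solver using (module +-*-Solver)
  open import Relation.Binary.PropositionalEquality
  open import Data.Empty using (⊥-elim)
  open import Relation.Nullary using (yes; no)

  open +-*-Solver

  ^-distribʳ-* : ∀ a b k → (a * b) ^ k ≡ a ^ k * b ^ k
  ^-distribʳ-* a b zero    = refl
  ^-distribʳ-* a b (suc k) rewrite ^-distribʳ-* a b k =
    solve 4 (λ a b x y → (a :* b) :* (x :* y) := (a :* x) :* (b :* y)) refl a b (a ^ k) (b ^ k)

  ^-cancelˡ-≤ : ∀ {a b} k → 1 ≤ k → a ^ k ≤ b ^ k → a ≤ b
  ^-cancelˡ-≤ {a} {b} (suc k) _ aᵏ≤bᵏ with a ≤? b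
  ... | yes a≤b = a≤b
  ... | no  a≰b = ⊥-elim (<⇒≱ (^-monoˡ-< (suc k) (≰⇒> a≰b)) aᵏ≤bᵏ)

  bernoulli : ∀ x k → x ^ suc k + suc k * x ^ k ≤ suc x ^ suc k
  bernoulli x zero    = ≤-reflexive (solve 1 (λ x → x :* con 1 :+ con 1 :* con 1 := (con 1 :+ x) :* con 1) refl x)
  bernoulli x (suc k) = begin
    x ^ suc (suc k) + suc (suc k) * x ^ suc k                     ≤⟨ m≤m+n _ _ ⟩
    x ^ suc (suc k) + suc (suc k) * x ^ suc k + suc k * x ^ k
      ≡⟨ solve 3 (λ x P k → x :* (x :* P) :+ (con 2 :+ k) :* (x :* P) :+ (con 1 :+ k) :* P
                          := (con 1 :+ x) :* (x :* P :+ (con 1 :+ k) :* P)) refl x (x ^ k) k ⟩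
    suc x * (x ^ suc k + suc k * x ^ k)                           ≤⟨ *-monoʳ-≤ (suc x) (bernoulli x k) ⟩
    suc x ^ suc (suc k)                                           ∎
    where open ≤-Reasoning

  pow-double : ∀ x q → suc x ≤ q → x ^ q * 2 ≤ suc x ^ q
  pow-double x q x<q = begin
    x ^ q * 2                    ≡⟨ cong (λ e → x ^ e * 2) (sym q≡) ⟩
    x ^ (suc x + t) * 2          ≡⟨ cong (_* 2) (^-distribˡ-+-* x (suc x) t) ⟩
    x ^ suc x * x ^ t * 2        ≡⟨ solve 2 (λ a b → a :* b :* con 2 := (a :* con 2) :* b) refl (x ^ suc x) (x ^ t) ⟩
    (x ^ suc x * 2) * x ^ t      ≤⟨ *-mono-≤ base (^-monoˡ-≤ t (n≤1+n x)) ⟩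
    suc x ^ suc x * suc x ^ t    ≡⟨ sym (^-distribˡ-+-* (suc x) (suc x) t) ⟩
    suc x ^ (suc x + t)          ≡⟨ cong (suc x ^_) q≡ ⟩
    suc x ^ q                    ∎
    where
    open ≤-Reasoning
    t : ℕ
    t = q ∸ suc x
    q≡ : suc x + t ≡ q
    q≡ = m+[n∸m]≡n x<q
    base : x ^ suc x * 2 ≤ suc x ^ suc x
    base = ≤-trans (≤-reflexive (solve 2 (λ x P → x :* P :* con 2 := x :* P :+ x :* P) refl x (x ^ x)))
           (≤-trans (+-monoʳ-≤ (x ^ suc x) (*-monoˡ-≤ (x ^ x) (n≤1+n x))) (bernoulli x x))

  pow-shift : ∀ p q → p ≤ q → (q ∸ p) ^ q * 2 ^ p ≤ q ^ q
  pow-shift zero    q _   = ≤-reflexive (*-identityʳ _)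
  pow-shift (suc p) q p<q = begin
    (q ∸ suc p) ^ q * (2 * 2 ^ p)   ≡⟨ sym (*-assoc ((q ∸ suc p) ^ q) 2 (2 ^ p)) ⟩
    ((q ∸ suc p) ^ q * 2) * 2 ^ p   ≤⟨ *-monoˡ-≤ (2 ^ p) (pow-double (q ∸ suc p) q
                                         (≤-trans (≤-reflexive (sym q∸p≡)) (m∸n≤m q p))) ⟩
    suc (q ∸ suc p) ^ q * 2 ^ p     ≡⟨ cong (λ z → z ^ q * 2 ^ p) (sym q∸p≡) ⟩
    (q ∸ p) ^ q * 2 ^ p             ≤⟨ pow-shift p q (<⇒≤ p<q) ⟩
    q ^ q                           ∎
    where
    open ≤-Reasoning
    q∸p≡ : q ∸ p ≡ suc (q ∸ suc p)
    q∸p≡ = +-∸-assoc 1 p<q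

  bernoulli-down : ∀ x N → N ≤ suc x → suc x ^ N * (suc x ∸ N) ≤ suc x * x ^ N
  bernoulli-down x zero    _         = ≤-reflexive (solve 1 (λ x → con 1 :* (con 1 :+ x) := (con 1 :+ x) :* con 1) refl x)
  bernoulli-down x (suc N) (s≤s N≤x) = begin
    suc x ^ suc N * (x ∸ N)       ≡⟨ solve 3 (λ S P d → S :* P :* d := P :* (S :* d)) refl (suc x) (suc x ^ N) d ⟩
    suc x ^ N * (suc x * d)       ≤⟨ *-monoʳ-≤ (suc x ^ N) key ⟩
    suc x ^ N * (suc d * x)       ≡⟨ solve 3 (λ P e x → P :* (e :* x) := P :* e :* x) refl (suc x ^ N) (suc d) x ⟩
    suc x ^ N * suc d * x         ≡⟨ cong (λ z → suc x ^ N * z * x) (sym (+-∸-assoc 1 N≤x)) ⟩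
    suc x ^ N * (suc x ∸ N) * x   ≤⟨ *-monoˡ-≤ x (bernoulli-down x N (≤-trans N≤x (n≤1+n x))) ⟩
    suc x * x ^ N * x             ≡⟨ solve 3 (λ S P x → S :* P :* x := S :* (x :* P)) refl (suc x) (x ^ N) x ⟩
    suc x * x ^ suc N             ∎
    where
    open ≤-Reasoning
    d : ℕ
    d = x ∸ N
    key : suc x * d ≤ suc d * x
    key = begin
      suc x * d   ≡⟨ solve 2 (λ x d → (con 1 :+ x) :* d := d :+ x :* d) refl x d ⟩
      d + x * d   ≤⟨ +-monoˡ-≤ (x * d) (m∸n≤m x N) ⟩
      x + x * d   ≡⟨ solve 2 (λ x d → x :+ x :* d := (con 1 :+ d) :* x) refl x d ⟩
      suc d * x   ∎

  pow-suc-≤-double : ∀ W N → N + N ≤ W → suc W ^ N ≤ 2 * W ^ N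
  pow-suc-≤-double W N 2N≤W = *-cancelʳ-≤ (suc W ^ N) (2 * W ^ N) (suc W) (begin
    suc W ^ N * suc W               ≤⟨ *-monoʳ-≤ (suc W ^ N) h ⟩
    suc W ^ N * (2 * (suc W ∸ N))   ≡⟨ solve 2 (λ P d → P :* (con 2 :* d) := con 2 :* (P :* d)) refl (suc W ^ N) (suc W ∸ N) ⟩
    2 * (suc W ^ N * (suc W ∸ N))   ≤⟨ *-monoʳ-≤ 2 (bernoulli-down W N N≤W+1) ⟩
    2 * (suc W * W ^ N)             ≡⟨ solve 3 (λ S P t → t :* (S :* P) := t :* P :* S) refl (suc W) (W ^ N) 2 ⟩
    2 * W ^ N * suc W               ∎)
    where
    open ≤-Reasoning
    N≤W+1 : N ≤ suc W
    N≤W+1 = ≤-trans (m≤m+n N N) (≤-trans 2N≤W (n≤1+n W))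
    h : suc W ≤ 2 * (suc W ∸ N)
    h = begin
      suc W                       ≡⟨ sym (m+[n∸m]≡n N≤W+1) ⟩
      N + (suc W ∸ N)             ≤⟨ +-monoˡ-≤ (suc W ∸ N) (m+n≤o⇒m≤o∸n N (≤-trans 2N≤W (n≤1+n W))) ⟩
      (suc W ∸ N) + (suc W ∸ N)   ≡⟨ solve 1 (λ d → d :+ d := con 2 :* d) refl (suc W ∸ N) ⟩
      2 * (suc W ∸ N)             ∎

  pow-shift-add : ∀ Y N z → N + N ≤ Y → (Y + z) ^ N ≤ 2 ^ z * Y ^ N
  pow-shift-add Y N zero    _    = ≤-reflexive (trans (cong (_^ N) (+-identityʳ Y)) (sym (+-identityʳ _)))
  pow-shift-add Y N (suc z) 2N≤Y = begin
    (Y + suc z) ^ N       ≡⟨ cong (_^ N) (+-suc Y z) ⟩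
    suc (Y + z) ^ N       ≤⟨ pow-suc-≤-double (Y + z) N (≤-trans 2N≤Y (m≤m+n Y z)) ⟩
    2 * (Y + z) ^ N       ≤⟨ *-monoʳ-≤ 2 (pow-shift-add Y N z 2N≤Y) ⟩
    2 * (2 ^ z * Y ^ N)   ≡⟨ sym (*-assoc 2 (2 ^ z) _) ⟩
    2 ^ suc z * Y ^ N     ∎
    where open ≤-Reasoning
  -- The one-coordinate inequality of the Chernoff bound, for the window
  -- parameters q = 2p + s and A = q - p:
  --   (A + q)^(2q²) · 2^(p²) ≤ 2^(2q²) · (A^s · q^(2p+q))^q.
  module PerCoordinate (p s : ℕ) where

    q : ℕ
    q = p + p + s
    A : ℕ
    A = p + s
    Q2 : ℕ
    Q2 = q * q

    q∸p≡A : q ∸ p ≡ A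
    q∸p≡A = trans (cong (_∸ p) (trans (+-assoc p p s) (+-comm p (p + s)))) (m+n∸n≡m (p + s) p)

    shifted : 2 ^ (p * (p + p)) * A ^ (q * (p + p)) ≤ q ^ (q * (p + p))
    shifted = begin
      2 ^ (p * (p + p)) * A ^ (q * (p + p))  ≡⟨ cong₂ _*_ (sym (^-*-assoc 2 p (p + p))) (sym (^-*-assoc A q (p + p))) ⟩
      (2 ^ p) ^ (p + p) * (A ^ q) ^ (p + p)  ≡⟨ sym (^-distribʳ-* (2 ^ p) (A ^ q) (p + p)) ⟩
      (2 ^ p * A ^ q) ^ (p + p)              ≡⟨ cong (_^ (p + p)) (*-comm (2 ^ p) (A ^ q)) ⟩
      (A ^ q * 2 ^ p) ^ (p + p)              ≤⟨ ^-monoˡ-≤ (p + p) Aᵠ2ᵖ≤qᵠ ⟩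
      (q ^ q) ^ (p + p)                      ≡⟨ ^-*-assoc q q (p + p) ⟩
      q ^ (q * (p + p))                      ∎
      where
      open ≤-Reasoning
      Aᵠ2ᵖ≤qᵠ : A ^ q * 2 ^ p ≤ q ^ q
      Aᵠ2ᵖ≤qᵠ = ≤-trans (≤-reflexive (cong (λ z → z ^ q * 2 ^ p) (sym q∸p≡A)))
                        (pow-shift p q (≤-trans (m≤m+n p p) (m≤m+n (p + p) s)))

    square : (A + q) ^ 2 ≡ 4 * (A * q) + p * p
    square = solve 2 (λ p s → ((p :+ s) :+ (p :+ p :+ s)) :* (((p :+ s) :+ (p :+ p :+ s)) :* con 1)
                            := con 4 :* ((p :+ s) :* (p :+ p :+ s)) :+ p :* p) refl p s

    2q²≤4Aq : Q2 + Q2 ≤ 4 * (A * q)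
    2q²≤4Aq = ≤-trans (≤-reflexive (solve 2 (λ p s → (p :+ p :+ s) :* (p :+ p :+ s) :+ (p :+ p :+ s) :* (p :+ p :+ s)
                                                  := con 2 :* ((p :+ p :+ s) :* (p :+ p :+ s))) refl p s))
              (≤-trans (*-monoʳ-≤ 2 (*-monoˡ-≤ q (+-monoʳ-≤ (p + p) (m≤m+n s s))))
                       (≤-reflexive (solve 2 (λ p s → con 2 :* ((p :+ p :+ (s :+ s)) :* (p :+ p :+ s))
                                                   := con 4 :* ((p :+ s) :* (p :+ p :+ s))) refl p s)))

    expand : 2 ^ (p * p) * (4 * (A * q)) ^ Q2 * 2 ^ (p * p)
           ≡ (2 ^ (p * (p + p)) * A ^ (q * (p + p))) * (4 ^ Q2 * A ^ (q * s) * q ^ Q2)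
    expand = begin-equality
      2 ^ (p * p) * (4 * (A * q)) ^ Q2 * 2 ^ (p * p)
        ≡⟨ cong (λ z → 2 ^ (p * p) * z * 2 ^ (p * p))
                (trans (^-distribʳ-* 4 (A * q) Q2) (cong (4 ^ Q2 *_) (^-distribʳ-* A q Q2))) ⟩
      2 ^ (p * p) * (4 ^ Q2 * (A ^ Q2 * q ^ Q2)) * 2 ^ (p * p)
        ≡⟨ cong (λ z → 2 ^ (p * p) * (4 ^ Q2 * (z * q ^ Q2)) * 2 ^ (p * p))
                (trans (cong (A ^_) (*-distribˡ-+ q (p + p) s)) (^-distribˡ-+-* A (q * (p + p)) (q * s))) ⟩
      2 ^ (p * p) * (4 ^ Q2 * ((A ^ (q * (p + p)) * A ^ (q * s)) * q ^ Q2)) * 2 ^ (p * p)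
        ≡⟨ solve 5 (λ t f a₁ a₂ b → t :* (f :* ((a₁ :* a₂) :* b)) :* t := (t :* t :* a₁) :* (f :* a₂ :* b)) refl
                   (2 ^ (p * p)) (4 ^ Q2) (A ^ (q * (p + p))) (A ^ (q * s)) (q ^ Q2) ⟩
      (2 ^ (p * p) * 2 ^ (p * p) * A ^ (q * (p + p))) * (4 ^ Q2 * A ^ (q * s) * q ^ Q2)
        ≡⟨ cong (λ z → (z * A ^ (q * (p + p))) * (4 ^ Q2 * A ^ (q * s) * q ^ Q2))
                (trans (sym (^-distribˡ-+-* 2 (p * p) (p * p))) (cong (2 ^_) (sym (*-distribˡ-+ p p p)))) ⟩
      (2 ^ (p * (p + p)) * A ^ (q * (p + p))) * (4 ^ Q2 * A ^ (q * s) * q ^ Q2)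
        ∎
      where open ≤-Reasoning

    collect : q ^ (q * (p + p)) * (4 ^ Q2 * A ^ (q * s) * q ^ Q2) ≡ 2 ^ (2 * Q2) * (A ^ s * q ^ (p + p + q)) ^ q
    collect = begin-equality
      q ^ (q * (p + p)) * (4 ^ Q2 * A ^ (q * s) * q ^ Q2)
        ≡⟨ solve 4 (λ x f a y → x :* (f :* a :* y) := f :* (a :* (x :* y))) refl
                   (q ^ (q * (p + p))) (4 ^ Q2) (A ^ (q * s)) (q ^ Q2) ⟩
      4 ^ Q2 * (A ^ (q * s) * (q ^ (q * (p + p)) * q ^ Q2))
        ≡⟨ cong₂ (λ u v → u * (A ^ (q * s) * v)) (^-*-assoc 2 2 Q2)
                 (trans (sym (^-distribˡ-+-* q (q * (p + p)) Q2)) (cong (q ^_) (sym (*-distribˡ-+ q (p + p) q)))) ⟩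
      2 ^ (2 * Q2) * (A ^ (q * s) * q ^ (q * (p + p + q)))
        ≡⟨ cong (2 ^ (2 * Q2) *_) (trans (cong₂ _*_ (power-swap A q s) (power-swap q q (p + p + q)))
                                         (sym (^-distribʳ-* (A ^ s) (q ^ (p + p + q)) q))) ⟩
      2 ^ (2 * Q2) * (A ^ s * q ^ (p + p + q)) ^ q
        ∎
      where
      open ≤-Reasoning
      power-swap : ∀ x m k → x ^ (m * k) ≡ (x ^ k) ^ m
      power-swap x m k = trans (cong (x ^_) (*-comm m k)) (sym (^-*-assoc x k m))

    per-coordinate : (A + q) ^ (2 * Q2) * 2 ^ (p * p) ≤ 2 ^ (2 * Q2) * (A ^ s * q ^ (p + p + q)) ^ q
    per-coordinate = begin
      (A + q) ^ (2 * Q2) * 2 ^ (p * p)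
        ≡⟨ cong (_* 2 ^ (p * p)) (trans (sym (^-*-assoc (A + q) 2 Q2)) (cong (_^ Q2) square)) ⟩
      (4 * (A * q) + p * p) ^ Q2 * 2 ^ (p * p)
        ≤⟨ *-monoˡ-≤ (2 ^ (p * p)) (pow-shift-add (4 * (A * q)) Q2 (p * p) 2q²≤4Aq) ⟩
      2 ^ (p * p) * (4 * (A * q)) ^ Q2 * 2 ^ (p * p)
        ≡⟨ expand ⟩
      (2 ^ (p * (p + p)) * A ^ (q * (p + p))) * (4 ^ Q2 * A ^ (q * s) * q ^ Q2)
        ≤⟨ *-monoˡ-≤ _ shifted ⟩
      q ^ (q * (p + p)) * (4 ^ Q2 * A ^ (q * s) * q ^ Q2)
        ≡⟨ collect ⟩
      2 ^ (2 * Q2) * (A ^ s * q ^ (p + p + q)) ^ q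
        ∎
      where open ≤-Reasoning

module CubeCounting where

  open import Data.Nat
  open import Data.Nat.Properties
  open import Data.Nat.Solver using (module +-*-Solver)
  open import Data.Bool using (Bool; true; false; not; T; if_then_else_)
  open import Data.Vec as Vec using (Vec; []; _∷_)
  open import Data.List using (List; []; _∷_; _++_; length; map)
  open import Data.List.Properties using (length-++; length-map)
  open import Data.List.Membership.Propositional using (_∈_)
  open import Data.List.Membership.Propositional.Properties using (∈-map⁺; ∈-++⁺ˡ; ∈-++⁺ʳ)
  open import Data.List.Relation.Unary.Any using (here)
  open import Relation.Binary.PropositionalEquality
  open import Algebra.Properties.CommutativeSemigroup +-commutativeSemigroup using (interchange)

  open +-*-Solver

  Σℕ : (m : ℕ) → (Vec Bool m → ℕ) → ℕ
  Σℕ zero    f = f []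
  Σℕ (suc m) f = Σℕ m (λ v → f (true ∷ v)) + Σℕ m (λ v → f (false ∷ v))

  Σℕ-mono : ∀ m {f g : Vec Bool m → ℕ} → (∀ v → f v ≤ g v) → Σℕ m f ≤ Σℕ m g
  Σℕ-mono zero    f≤g = f≤g []
  Σℕ-mono (suc m) f≤g = +-mono-≤ (Σℕ-mono m (λ v → f≤g (true ∷ v))) (Σℕ-mono m (λ v → f≤g (false ∷ v)))

  Σℕ-+ : ∀ m (f g : Vec Bool m → ℕ) → Σℕ m (λ v → f v + g v) ≡ Σℕ m f + Σℕ m g
  Σℕ-+ zero    f g = refl
  Σℕ-+ (suc m) f g = trans (cong₂ _+_ (Σℕ-+ m (λ v → f (true ∷ v)) (λ v → g (true ∷ v)))
                                     (Σℕ-+ m (λ v → f (false ∷ v)) (λ v → g (false ∷ v))))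
                           (interchange (Σℕ m (λ v → f (true ∷ v))) _ _ _)

  Σℕ-*ˡ : ∀ m c (f : Vec Bool m → ℕ) → Σℕ m (λ v → c * f v) ≡ c * Σℕ m f
  Σℕ-*ˡ zero    c f = refl
  Σℕ-*ˡ (suc m) c f rewrite Σℕ-*ˡ m c (λ v → f (true ∷ v)) | Σℕ-*ˡ m c (λ v → f (false ∷ v)) =
    sym (*-distribˡ-+ c _ _)

  complement : ∀ {m} → Vec Bool m → Vec Bool m
  complement = Vec.map not

  Σℕ-complement : ∀ m (f : Vec Bool m → ℕ) → Σℕ m (λ v → f (complement v)) ≡ Σℕ m f
  Σℕ-complement zero    f = refl
  Σℕ-complement (suc m) f =
    trans (cong₂ _+_ (Σℕ-complement m (λ v → f (false ∷ v))) (Σℕ-complement m (λ v → f (true ∷ v))))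
          (+-comm (Σℕ m (λ v → f (false ∷ v))) _)

  weight-complement : ∀ {m} (u : Vec Bool m) → weight (complement u) + weight u ≡ m
  weight-complement []          = refl
  weight-complement (true ∷ u)  = trans (+-suc _ _) (cong suc (weight-complement u))
  weight-complement (false ∷ u) = cong suc (weight-complement u)

  weight≤ : ∀ {m} (u : Vec Bool m) → weight u ≤ m
  weight≤ []          = z≤n
  weight≤ (true ∷ u)  = s≤s (weight≤ u)
  weight≤ (false ∷ u) = m≤n⇒m≤1+n (weight≤ u)

  indicator : Bool → ℕ
  indicator b = if b then 1 else 0

  indicator-T : ∀ {b} → T b → 1 ≤ indicator b
  indicator-T {true} _ = ≤-refl

  count : (m : ℕ) → (Vec Bool m → Bool) → ℕ
  count m P = Σℕ m (λ v → indicator (P v))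

  points : (m : ℕ) → (Vec Bool m → Bool) → List (Vec Bool m)
  points zero    P = if P [] then [] ∷ [] else []
  points (suc m) P = map (true ∷_) (points m (λ v → P (true ∷ v))) ++ map (false ∷_) (points m (λ v → P (false ∷ v)))

  length-points : ∀ m P → length (points m P) ≡ count m P
  length-points zero    P with P []
  ... | true  = refl
  ... | false = refl
  length-points (suc m) P = begin
    length (map (true ∷_) (points m Pt) ++ map (false ∷_) (points m Pf))   ≡⟨ length-++ (map (true ∷_) (points m Pt)) ⟩
    length (map (true ∷_) (points m Pt)) + length (map (false ∷_) (points m Pf))
      ≡⟨ cong₂ _+_ (trans (length-map _ (points m Pt)) (length-points m Pt))
                   (trans (length-map _ (points m Pf)) (length-points m Pf)) ⟩
    count m Pt + count m Pf   ∎
    where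
    open ≡-Reasoning
    Pt : Vec Bool m → Bool
    Pt = λ v → P (true ∷ v)
    Pf : Vec Bool m → Bool
    Pf = λ v → P (false ∷ v)

  points-complete : ∀ m P v → T (P v) → v ∈ points m P
  points-complete zero    P [] Pv with P []
  ... | true = here refl
  points-complete (suc m) P (true ∷ v)  Pv = ∈-++⁺ˡ (∈-map⁺ (true ∷_) (points-complete m _ v Pv))
  points-complete (suc m) P (false ∷ v) Pv = ∈-++⁺ʳ _ (∈-map⁺ (false ∷_) (points-complete m _ v Pv))

  monomial : ℕ → ℕ → ∀ {m} → Vec Bool m → ℕ
  monomial A B []          = 1
  monomial A B (true ∷ u)  = A * monomial A B u
  monomial A B (false ∷ u) = B * monomial A B u

  Σℕ-monomial : ∀ A B m → Σℕ m (monomial A B) ≡ (A + B) ^ m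
  Σℕ-monomial A B zero    = refl
  Σℕ-monomial A B (suc m) = begin
    Σℕ m (λ v → A * monomial A B v) + Σℕ m (λ v → B * monomial A B v)  ≡⟨ cong₂ _+_ (Σℕ-*ˡ m A _) (Σℕ-*ˡ m B _) ⟩
    A * Σℕ m (monomial A B) + B * Σℕ m (monomial A B)                  ≡⟨ sym (*-distribʳ-+ _ A B) ⟩
    (A + B) * Σℕ m (monomial A B)                                      ≡⟨ cong ((A + B) *_) (Σℕ-monomial A B m) ⟩
    (A + B) ^ suc m                                                    ∎
    where open ≡-Reasoning

  monomial-lower : ∀ A B → A ≤ B → ∀ {m} (u : Vec Bool m) W V → weight u ≤ W → W + V ≡ m →
                   A ^ W * B ^ V ≤ monomial A B u
  monomial-lower A B A≤B [] zero zero _ _ = ≤-refl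
  monomial-lower A B A≤B (true ∷ u) (suc W) V (s≤s |u|≤W) W+V≡ =
    ≤-trans (≤-reflexive (*-assoc A (A ^ W) (B ^ V)))
            (*-monoʳ-≤ A (monomial-lower A B A≤B u W V |u|≤W (suc-injective W+V≡)))
  monomial-lower A B A≤B {suc m} (false ∷ u) W (suc V) |u|≤W W+V≡ =
    ≤-trans (≤-reflexive (+-*-Solver.solve 3 (λ a b c → a :* (b :* c) := b :* (a :* c)) refl (A ^ W) B (B ^ V)))
            (*-monoʳ-≤ B (monomial-lower A B A≤B u W V |u|≤W (suc-injective (trans (sym (+-suc W V)) W+V≡))))
  monomial-lower A B A≤B {suc m} (false ∷ u) W zero |u|≤W W+0≡ = begin
    A ^ W * 1      ≡⟨ cong (λ e → A ^ e * 1) (trans (sym (+-identityʳ W)) W+0≡) ⟩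
    A * A ^ m * 1  ≡⟨ *-identityʳ _ ⟩
    A * A ^ m      ≤⟨ *-mono-≤ A≤B (≤-trans (≤-reflexive (sym (*-identityʳ _)))
                                         (monomial-lower A B A≤B u m zero (weight≤ u) (+-identityʳ m))) ⟩
    B * monomial A B u  ∎
    where open ≤-Reasoning

  count-light : ∀ A B → A ≤ B → ∀ m W → W ≤ m → (P : Vec Bool m → Bool) →
                (∀ u → T (P u) → weight u ≤ W) → count m P * (A ^ W * B ^ (m ∸ W)) ≤ (A + B) ^ m
  count-light A B A≤B m W W≤m P light = begin
    count m P * g                       ≡⟨ *-comm (count m P) g ⟩
    g * count m P                       ≡⟨ sym (Σℕ-*ˡ m g _) ⟩
    Σℕ m (λ u → g * indicator (P u))    ≤⟨ Σℕ-mono m term ⟩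
    Σℕ m (monomial A B)                 ≡⟨ Σℕ-monomial A B m ⟩
    (A + B) ^ m                         ∎
    where
    open ≤-Reasoning
    g : ℕ
    g = A ^ W * B ^ (m ∸ W)
    term : ∀ u → g * indicator (P u) ≤ monomial A B u
    term u with P u in eq
    ... | false = ≤-trans (≤-reflexive (*-zeroʳ g)) z≤n
    ... | true  = ≤-trans (≤-reflexive (*-identityʳ g))
                          (monomial-lower A B A≤B u W (m ∸ W) (light u (subst T (sym eq) _)) (m+[n∸m]≡n W≤m))

-- The central window for a = p/q with q = 2p + s:  s·n ≤ 2q·|u| ≤ (2p+q)·n,
-- i.e. (1/2 - a)·n ≤ |u| ≤ (1/2 + a)·n, and the bound L^(2q²) · 2^(p²n) ≤ 2^(2q²n)
-- on the number L of points below it.  Points above it are complements of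
-- points below it, so at most 2L points are outside the window.
module BinomialTail (p s n : ℕ) .{{_ : NonZero s}} where

  open import Data.Nat
  open import Data.Nat.Properties
  open import Data.Nat.DivMod using (_/_; m*n/n≡m; /-monoˡ-≤; m/n*n≤m)
  open import Data.Nat.Solver using (module +-*-Solver)
  open import Data.Bool using (Bool; true; false; not; T; _∧_)
  open import Data.Vec using (Vec)
  open import Data.Sum using (_⊎_; inj₁; inj₂)
  open import Data.Product using (_×_; _,_)
  open import Relation.Binary.PropositionalEquality

  open PowerInequalities
  open PerCoordinate p s public
  open CubeCounting

  α : ℕ
  α = s * n
  β : ℕ
  β = 2 * q
  γ : ℕ
  γ = (p + p + q) * n

  instance
    A-nonZero : NonZero A
    A-nonZero = >-nonZero (≤-trans (>-nonZero⁻¹ s) (m≤n+m s p))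
    q-nonZero : NonZero q
    q-nonZero = >-nonZero (≤-trans (>-nonZero⁻¹ s) (m≤n+m s (p + p)))
    β-nonZero : NonZero β
    β-nonZero = m*n≢0 2 q

  α+γ≡nβ : α + γ ≡ n * β
  α+γ≡nβ = +-*-Solver.solve 3 (λ p s n → s :* n :+ (p :+ p :+ (p :+ p :+ s)) :* n := n :* (con 2 :* (p :+ p :+ s)))
             refl p s n
    where open +-*-Solver

  central : Vec Bool n → Bool
  central u = (α ≤ᵇ β * weight u) ∧ (β * weight u ≤ᵇ γ)

  light : Vec Bool n → Bool
  light u = β * weight u <ᵇ α

  central-sound : ∀ u → T (central u) → (α ≤ β * weight u) × (β * weight u ≤ γ)
  central-sound u c with α ≤ᵇ β * weight u in e₁ | β * weight u ≤ᵇ γ in e₂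
  ... | true | true = ≤ᵇ⇒≤ α _ (subst T (sym e₁) _) , ≤ᵇ⇒≤ _ γ (subst T (sym e₂) _)

  complement-light : ∀ u → γ < β * weight u → β * weight (complement u) < α
  complement-light u γ<βu = +-cancelʳ-< (β * weight u) _ _ (begin-strict
    β * weight (complement u) + β * weight u   ≡⟨ sym (*-distribˡ-+ β (weight (complement u)) (weight u)) ⟩
    β * (weight (complement u) + weight u)     ≡⟨ cong (β *_) (weight-complement u) ⟩
    β * n                                      ≡⟨ trans (*-comm β n) (sym α+γ≡nβ) ⟩
    α + γ                                      <⟨ +-monoʳ-< α γ<βu ⟩
    α + β * weight u                           ∎)
    where open ≤-Reasoning

  noncentral-light : ∀ u → central u ≡ false → T (light u) ⊎ T (light (complement u))
  noncentral-light u eq with α ≤ᵇ β * weight u in e₁ | β * weight u ≤ᵇ γ in e₂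
  ... | false | _     = inj₁ (<⇒<ᵇ {β * weight u} {α} (≰⇒> (λ α≤ → subst T e₁ (≤⇒≤ᵇ α≤))))
  ... | true  | false = inj₂ (<⇒<ᵇ {β * weight (complement u)} {α}
                                   (complement-light u (≰⇒> (λ ≤γ → subst T e₂ (≤⇒≤ᵇ ≤γ)))))

  L : ℕ
  L = count n light

  noncentral-count : count n (λ u → not (central u)) ≤ L + L
  noncentral-count = begin
    count n (λ u → not (central u))                                     ≤⟨ Σℕ-mono n split ⟩
    Σℕ n (λ u → indicator (light u) + indicator (light (complement u)))  ≡⟨ Σℕ-+ n _ _ ⟩
    L + Σℕ n (λ u → indicator (light (complement u)))                    ≡⟨ cong (L +_) (Σℕ-complement n _) ⟩
    L + L                                                               ∎
    where
    open ≤-Reasoning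
    split : ∀ u → indicator (not (central u)) ≤ indicator (light u) + indicator (light (complement u))
    split u with central u in eq
    ... | true  = z≤n
    ... | false with noncentral-light u eq
    ...   | inj₁ l = ≤-trans (indicator-T l) (m≤m+n _ _)
    ...   | inj₂ l = ≤-trans (indicator-T l) (m≤n+m _ _)

  W : ℕ
  W = α / β
  V : ℕ
  V = n ∸ W
  g : ℕ
  g = A ^ W * q ^ V

  W≤n : W ≤ n
  W≤n = ≤-trans (/-monoˡ-≤ β (≤-trans (m≤m+n α γ) (≤-reflexive α+γ≡nβ))) (≤-reflexive (m*n/n≡m n β))

  A≤q : A ≤ q
  A≤q = ≤-trans (m≤n+m (p + s) p) (≤-reflexive (sym (+-assoc p p s)))

  light-weight : ∀ u → T (light u) → weight u ≤ W
  light-weight u l = ≤-trans (≤-reflexive (sym (m*n/n≡m (weight u) β)))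
    (/-monoˡ-≤ β (≤-trans (≤-reflexive (*-comm (weight u) β)) (<⇒≤ (<ᵇ⇒< _ α l))))

  L·g≤ : L * g ≤ (A + q) ^ n
  L·g≤ = count-light A q A≤q n W W≤n light light-weight

  G : ℕ
  G = A ^ α * q ^ γ

  -- Rounding the threshold down only helps: A ≤ q.
  G≤gᵝ : G ≤ g ^ β
  G≤gᵝ = begin
    A ^ α * q ^ γ                   ≡⟨ cong (λ e → A ^ e * q ^ γ) (sym (m+[n∸m]≡n Wβ≤α)) ⟩
    A ^ (W * β + δ) * q ^ γ         ≡⟨ cong (_* q ^ γ) (^-distribˡ-+-* A (W * β) δ) ⟩
    A ^ (W * β) * A ^ δ * q ^ γ     ≤⟨ *-monoˡ-≤ (q ^ γ) (*-monoʳ-≤ (A ^ (W * β)) (^-monoˡ-≤ δ A≤q)) ⟩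
    A ^ (W * β) * q ^ δ * q ^ γ     ≡⟨ *-assoc (A ^ (W * β)) (q ^ δ) (q ^ γ) ⟩
    A ^ (W * β) * (q ^ δ * q ^ γ)   ≡⟨ cong (A ^ (W * β) *_) (sym (^-distribˡ-+-* q δ γ)) ⟩
    A ^ (W * β) * q ^ (δ + γ)       ≡⟨ cong (λ e → A ^ (W * β) * q ^ e) (sym Vβ≡) ⟩
    A ^ (W * β) * q ^ (V * β)       ≡⟨ cong₂ _*_ (sym (^-*-assoc A W β)) (sym (^-*-assoc q V β)) ⟩
    (A ^ W) ^ β * (q ^ V) ^ β       ≡⟨ sym (^-distribʳ-* (A ^ W) (q ^ V) β) ⟩
    g ^ β                           ∎
    where
    open ≤-Reasoning
    Wβ≤α : W * β ≤ α
    Wβ≤α = m/n*n≤m α β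
    δ : ℕ
    δ = α ∸ W * β
    Vβ≡ : V * β ≡ δ + γ
    Vβ≡ = begin-equality
      (n ∸ W) * β      ≡⟨ *-distribʳ-∸ β n W ⟩
      n * β ∸ W * β    ≡⟨ cong (_∸ W * β) (sym α+γ≡nβ) ⟩
      α + γ ∸ W * β    ≡⟨ +-∸-comm γ Wβ≤α ⟩
      δ + γ            ∎

  E : ℕ
  E = 2 * Q2

  per-coordinate-ⁿ : ((A + q) ^ n) ^ E * 2 ^ (p * p * n) ≤ 2 ^ (E * n) * G ^ q
  per-coordinate-ⁿ = begin
    ((A + q) ^ n) ^ E * 2 ^ (p * p * n)
      ≡⟨ cong₂ _*_ (trans (^-*-assoc (A + q) n E) (trans (cong ((A + q) ^_) (*-comm n E)) (sym (^-*-assoc (A + q) E n))))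
                   (sym (^-*-assoc 2 (p * p) n)) ⟩
    ((A + q) ^ E) ^ n * (2 ^ (p * p)) ^ n                ≡⟨ sym (^-distribʳ-* ((A + q) ^ E) (2 ^ (p * p)) n) ⟩
    ((A + q) ^ E * 2 ^ (p * p)) ^ n                      ≤⟨ ^-monoˡ-≤ n per-coordinate ⟩
    (2 ^ E * (A ^ s * q ^ (p + p + q)) ^ q) ^ n          ≡⟨ ^-distribʳ-* (2 ^ E) _ n ⟩
    (2 ^ E) ^ n * ((A ^ s * q ^ (p + p + q)) ^ q) ^ n    ≡⟨ cong₂ _*_ (^-*-assoc 2 E n) regroup ⟩
    2 ^ (E * n) * G ^ q                                  ∎
    where
    open ≤-Reasoning
    regroup : ((A ^ s * q ^ (p + p + q)) ^ q) ^ n ≡ G ^ q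
    regroup = begin-equality
      ((A ^ s * q ^ (p + p + q)) ^ q) ^ n   ≡⟨ ^-*-assoc _ q n ⟩
      (A ^ s * q ^ (p + p + q)) ^ (q * n)   ≡⟨ cong ((A ^ s * q ^ (p + p + q)) ^_) (*-comm q n) ⟩
      (A ^ s * q ^ (p + p + q)) ^ (n * q)   ≡⟨ sym (^-*-assoc _ n q) ⟩
      ((A ^ s * q ^ (p + p + q)) ^ n) ^ q   ≡⟨ cong (_^ q) (trans (^-distribʳ-* (A ^ s) _ n)
                                                   (cong₂ _*_ (^-*-assoc A s n) (^-*-assoc q (p + p + q) n))) ⟩
      G ^ q                                 ∎

  -- L ≤ 2^(n - p²n/(2q²)), in integer form.
  tail-bound : L ^ E * 2 ^ (p * p * n) ≤ 2 ^ (E * n)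
  tail-bound = *-cancelʳ-≤ (L ^ E * 2 ^ (p * p * n)) (2 ^ (E * n)) (G ^ q) {{Gᵠ-nonZero}} (begin
    L ^ E * 2 ^ (p * p * n) * G ^ q         ≤⟨ *-monoʳ-≤ (L ^ E * 2 ^ (p * p * n)) (^-monoˡ-≤ q G≤gᵝ) ⟩
    L ^ E * 2 ^ (p * p * n) * (g ^ β) ^ q   ≡⟨ cong (L ^ E * 2 ^ (p * p * n) *_) (trans (^-*-assoc g β q) (cong (g ^_) βq≡E)) ⟩
    L ^ E * 2 ^ (p * p * n) * g ^ E         ≡⟨ +-*-Solver.solve 3 (λ a b c → a :* b :* c := a :* c :* b) refl (L ^ E) (2 ^ (p * p * n)) (g ^ E) ⟩
    L ^ E * g ^ E * 2 ^ (p * p * n)         ≡⟨ cong (_* 2 ^ (p * p * n)) (sym (^-distribʳ-* L g E)) ⟩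
    (L * g) ^ E * 2 ^ (p * p * n)           ≤⟨ *-monoˡ-≤ (2 ^ (p * p * n)) (^-monoˡ-≤ E L·g≤) ⟩
    ((A + q) ^ n) ^ E * 2 ^ (p * p * n)     ≤⟨ per-coordinate-ⁿ ⟩
    2 ^ (E * n) * G ^ q                     ∎)
    where
    open ≤-Reasoning
    open +-*-Solver
    βq≡E : β * q ≡ E
    βq≡E = *-assoc 2 q q
    Gᵠ-nonZero : NonZero (G ^ q)
    Gᵠ-nonZero = m^n≢0 G q {{m*n≢0 (A ^ α) (q ^ γ) {{m^n≢0 A α}} {{m^n≢0 q γ}}}}

  p²n≤En : p * p * n ≤ E * n
  p²n≤En = *-monoˡ-≤ n (≤-trans (*-mono-≤ p≤q p≤q) (m≤m+n (q * q) _))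
    where
    p≤q : p ≤ q
    p≤q = ≤-trans (m≤m+n p p) (m≤m+n (p + p) s)

  light-count : L ^ E ≤ 2 ^ (E * n ∸ p * p * n)
  light-count = *-cancelʳ-≤ (L ^ E) (2 ^ (E * n ∸ p * p * n)) (2 ^ (p * p * n)) {{m^n≢0 2 (p * p * n)}}
    (≤-trans tail-bound (≤-reflexive (trans (cong (2 ^_) (sym (m∸n+n≡m p²n≤En)))
                                            (^-distribˡ-+-* 2 (E * n ∸ p * p * n) (p * p * n)))))

module RationalBookkeeping where

  open import Data.Nat as ℕ using (ℕ; suc; zero)
  import Data.Nat.Properties as NP
  open import Data.Integer as ℤ using (ℤ; +_; +[1+_]; -[1+_])
  import Data.Integer.Properties as ZP
  open import Data.Rational as ℚ using (ℚ; mkℚ; toℚᵘ; ½; 0ℚ; ↥_; ↧_)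
  import Data.Rational.Properties as QP
  open import Data.Rational.Unnormalised as ℚᵘ using (ℚᵘ; mkℚᵘ; *≤*; *≡*)
  import Data.Rational.Unnormalised.Properties as QuP
  open import Data.Product using (Σ; _,_)
  open import Relation.Binary.PropositionalEquality
  open import Data.Nat.Coprimality using (Coprime)

  open PowerInequalities using (^-distribʳ-*; ^-cancelˡ-≤)

  0<½ : 0ℚ ℚ.< ½
  0<½ = ℚ.*<* (ℤ.+<+ (ℕ.s≤s ℕ.z≤n))

  window-split : ∀ p₀ d .(c : Coprime (suc p₀) (suc d)) → mkℚ +[1+ p₀ ] d c ℚ.< ½ →
                 Σ ℕ (λ s′ → d ≡ p₀ ℕ.+ suc p₀ ℕ.+ suc s′)
  window-split p₀ d c (ℚ.*<* lt) = d ℕ.∸ suc X , sym (trans (NP.+-suc X _) (NP.m+[n∸m]≡n X<d))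
    where
    X : ℕ
    X = p₀ ℕ.+ suc p₀
    2p≡ : suc p₀ ℕ.+ suc p₀ ≡ suc p₀ ℕ.* 2
    2p≡ = trans (cong (suc p₀ ℕ.+_) (sym (NP.+-identityʳ (suc p₀)))) (NP.*-comm 2 (suc p₀))
    X<d : suc X ℕ.≤ d
    X<d = NP.≤-pred (NP.≤-trans (NP.≤-reflexive (cong suc 2p≡))
                    (NP.≤-trans (ZP.drop‿+<+ lt) (NP.≤-reflexive (NP.+-identityʳ (suc d)))))

  -- Pow2Le x y e for e = P/Q follows from x^Q ≤ y^Q · 2^P (raise to the
  -- power ↧e, then take Q-th roots).
  pow2le-intro : ∀ x y (e : ℚ) (Q P : ℕ) → 1 ℕ.≤ Q → ↥ e ℤ.* + Q ≡ + P ℤ.* ↧ e →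
                 x ℕ.^ Q ℕ.≤ y ℕ.^ Q ℕ.* 2 ℕ.^ P → Pow2Le x y e
  pow2le-intro x y (mkℚ (+ P₀) d c) Q P 1≤Q eQ xᵠ≤ = ^-cancelˡ-≤ Q 1≤Q (begin
    (x ℕ.^ D) ℕ.^ Q                       ≡⟨ swap x ⟩
    (x ℕ.^ Q) ℕ.^ D                       ≤⟨ NP.^-monoˡ-≤ D xᵠ≤ ⟩
    (y ℕ.^ Q ℕ.* 2 ℕ.^ P) ℕ.^ D           ≡⟨ ^-distribʳ-* (y ℕ.^ Q) (2 ℕ.^ P) D ⟩
    (y ℕ.^ Q) ℕ.^ D ℕ.* (2 ℕ.^ P) ℕ.^ D   ≡⟨ cong₂ ℕ._*_ (sym (swap y)) two ⟩
    (y ℕ.^ D) ℕ.^ Q ℕ.* (2 ℕ.^ P₀) ℕ.^ Q  ≡⟨ sym (^-distribʳ-* (y ℕ.^ D) (2 ℕ.^ P₀) Q) ⟩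
    (y ℕ.^ D ℕ.* 2 ℕ.^ P₀) ℕ.^ Q          ∎)
    where
    open NP.≤-Reasoning
    D : ℕ
    D = suc d
    swap : ∀ z → (z ℕ.^ D) ℕ.^ Q ≡ (z ℕ.^ Q) ℕ.^ D
    swap z = trans (NP.^-*-assoc z D Q) (trans (cong (z ℕ.^_) (NP.*-comm D Q)) (sym (NP.^-*-assoc z Q D)))
    P₀Q≡PD : P₀ ℕ.* Q ≡ P ℕ.* D
    P₀Q≡PD = ZP.+-injective (trans (ZP.pos-* P₀ Q) (trans eQ (sym (ZP.pos-* P D))))
    two : (2 ℕ.^ P) ℕ.^ D ≡ (2 ℕ.^ P₀) ℕ.^ Q
    two = trans (NP.^-*-assoc 2 P D) (trans (cong (2 ℕ.^_) (sym P₀Q≡PD)) (sym (NP.^-*-assoc 2 P₀ Q)))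
  pow2le-intro x y (mkℚ -[1+ m ] d c) (suc Q) P 1≤Q eQ xᵠ≤ with trans eQ (sym (ZP.pos-* P (suc d)))
  ... | ()

  ↥toℚᵘ : ∀ x → ℚᵘ.↥ (toℚᵘ x) ≡ ↥ x
  ↥toℚᵘ (mkℚ _ _ _) = refl

  ↧toℚᵘ : ∀ x → ℚᵘ.↧ (toℚᵘ x) ≡ ↧ x
  ↧toℚᵘ (mkℚ _ _ _) = refl

  toℚᵘ-fromℕ : ∀ n → toℚᵘ (+ n ℚ./ 1) ℚᵘ.≃ mkℚᵘ (+ n) 0
  toℚᵘ-fromℕ n = QP.toℚᵘ-fromℚᵘ (mkℚᵘ (+ n) 0)

  -- a = p/q in lowest terms with q = 2p + s (s ≥ 1); here the denominator of
  -- a is definitionally q.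
  module Fraction (p₀ s′ : ℕ) .(c : Coprime (suc p₀) (suc (p₀ ℕ.+ suc p₀ ℕ.+ suc s′))) where

    open import Data.Nat.Solver using (module +-*-Solver)
    open +-*-Solver

    p : ℕ
    p = suc p₀
    s : ℕ
    s = suc s′
    q : ℕ
    q = p ℕ.+ p ℕ.+ s

    a : ℚ
    a = mkℚ (+ p) (p₀ ℕ.+ suc p₀ ℕ.+ suc s′) c

    aᵘ ½ᵘ : ℚᵘ
    aᵘ = mkℚᵘ (+ p) (p₀ ℕ.+ suc p₀ ℕ.+ suc s′)
    ½ᵘ = mkℚᵘ (+ 1) 1

    fromℕᵘ : ℕ → ℚᵘ
    fromℕᵘ m = mkℚᵘ (+ m) 0

    -- The exponent n - a²n/2 equals P/Q with Q = 2q² and P = Qn - p²n.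
    module Exponent (n : ℕ) where

      Q : ℕ
      Q = 2 ℕ.* (q ℕ.* q)
      P : ℕ
      P = Q ℕ.* n ℕ.∸ p ℕ.* p ℕ.* n

      e : ℚ
      e = (+ n ℚ./ 1) ℚ.- ½ ℚ.* a ℚ.* a ℚ.* (+ n ℚ./ 1)

      Z : ℚᵘ
      Z = fromℕᵘ n ℚᵘ.+ ℚᵘ.- (½ᵘ ℚᵘ.* aᵘ ℚᵘ.* aᵘ ℚᵘ.* fromℕᵘ n)

      e≃Z : toℚᵘ e ℚᵘ.≃ Z
      e≃Z = QuP.≃-trans (QP.toℚᵘ-homo-+ (+ n ℚ./ 1) (ℚ.- (½ ℚ.* a ℚ.* a ℚ.* (+ n ℚ./ 1))))
        (QuP.+-cong (toℚᵘ-fromℕ n) (QuP.≃-trans (QP.toℚᵘ-homo‿- (½ ℚ.* a ℚ.* a ℚ.* (+ n ℚ./ 1)))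
          (QuP.-‿cong (QuP.≃-trans (QP.toℚᵘ-homo-* (½ ℚ.* a ℚ.* a) (+ n ℚ./ 1))
            (QuP.*-cong (QuP.≃-trans (QP.toℚᵘ-homo-* (½ ℚ.* a) a)
              (QuP.*-cong (QP.toℚᵘ-homo-* ½ a) QuP.≃-refl)) (toℚᵘ-fromℕ n))))))

      D : ℕ
      D = 2 ℕ.* q ℕ.* q ℕ.* 1

      D≡Q : 1 ℕ.* D ≡ Q
      D≡Q = solve 1 (λ q → con 1 :* (con 2 :* q :* q :* con 1) := con 2 :* (q :* q)) refl q

      p²n : ℕ
      p²n = 1 ℕ.* p ℕ.* p ℕ.* n

      p²n≤nD : p²n ℕ.≤ n ℕ.* D
      p²n≤nD = NP.≤-trans (NP.≤-reflexive (solve 2 (λ p n → con 1 :* p :* p :* n := n :* (p :* p)) refl p n))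
        (NP.*-monoʳ-≤ n (NP.≤-trans (NP.*-mono-≤ p≤q p≤q) (NP.≤-trans (NP.m≤m+n (q ℕ.* q) _)
          (NP.≤-reflexive (solve 1 (λ q → q :* q :+ (q :+ con 0) :* q := con 2 :* q :* q :* con 1) refl q)))))
        where
        p≤q : p ℕ.≤ q
        p≤q = NP.≤-trans (NP.m≤m+n p p) (NP.m≤m+n (p ℕ.+ p) s)

      ↥Z≡P : ℚᵘ.↥ Z ≡ + P
      ↥Z≡P = begin
        + n ℤ.* + D ℤ.+ (ℤ.- (+ 1 ℤ.* + p ℤ.* + p ℤ.* + n)) ℤ.* + 1
          ≡⟨ cong₂ ℤ._+_ (sym (ZP.pos-* n D)) (trans (ZP.*-identityʳ _) (cong ℤ.-_ p²n≡)) ⟩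
        + (n ℕ.* D) ℤ.- + p²n      ≡⟨ ZP.m-n≡m⊖n (n ℕ.* D) p²n ⟩
        (n ℕ.* D) ℤ.⊖ p²n          ≡⟨ ZP.⊖-≥ p²n≤nD ⟩
        + (n ℕ.* D ℕ.∸ p²n)        ≡⟨ cong +_ (cong₂ ℕ._∸_ nD≡Qn (solve 2 (λ p n → con 1 :* p :* p :* n := p :* p :* n) refl p n)) ⟩
        + P                        ∎
        where
        open ≡-Reasoning
        p²n≡ : + 1 ℤ.* + p ℤ.* + p ℤ.* + n ≡ + p²n
        p²n≡ = trans (cong (λ z → z ℤ.* + p ℤ.* + n) (sym (ZP.pos-* 1 p)))
                 (trans (cong (ℤ._* + n) (sym (ZP.pos-* (1 ℕ.* p) p))) (sym (ZP.pos-* (1 ℕ.* p ℕ.* p) n)))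
        nD≡Qn : n ℕ.* D ≡ Q ℕ.* n
        nD≡Qn = trans (NP.*-comm n D) (cong (ℕ._* n) (trans (sym (NP.*-identityˡ D)) D≡Q))

      exponent-ratio : ↥ e ℤ.* + Q ≡ + P ℤ.* ↧ e
      exponent-ratio = begin
        ↥ e ℤ.* + Q                 ≡⟨ cong₂ ℤ._*_ (sym (↥toℚᵘ e)) (cong +_ (sym D≡Q)) ⟩
        ℚᵘ.↥ (toℚᵘ e) ℤ.* ℚᵘ.↧ Z    ≡⟨ cross e≃Z ⟩
        ℚᵘ.↥ Z ℤ.* ℚᵘ.↧ (toℚᵘ e)    ≡⟨ cong₂ ℤ._*_ ↥Z≡P (↧toℚᵘ e) ⟩
        + P ℤ.* ↧ e                 ∎
        where
        open ≡-Reasoning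
        cross : ∀ {x y} → x ℚᵘ.≃ y → ℚᵘ.↥ x ℤ.* ℚᵘ.↧ y ≡ ℚᵘ.↥ y ℤ.* ℚᵘ.↧ x
        cross (*≡* h) = h

    module Window (n w : ℕ) where

      L′ U′ : ℚᵘ
      L′ = (½ᵘ ℚᵘ.+ ℚᵘ.- aᵘ) ℚᵘ.* fromℕᵘ n
      U′ = (½ᵘ ℚᵘ.+ aᵘ) ℚᵘ.* fromℕᵘ n

      L≃ : toℚᵘ ((½ ℚ.- a) ℚ.* (+ n ℚ./ 1)) ℚᵘ.≃ L′
      L≃ = QuP.≃-trans (QP.toℚᵘ-homo-* (½ ℚ.- a) (+ n ℚ./ 1))
             (QuP.*-cong (QuP.≃-trans (QP.toℚᵘ-homo-+ ½ (ℚ.- a)) (QuP.+-cong (QuP.≃-refl {½ᵘ}) (QP.toℚᵘ-homo‿- a)))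
                         (toℚᵘ-fromℕ n))

      U≃ : toℚᵘ ((½ ℚ.+ a) ℚ.* (+ n ℚ./ 1)) ℚᵘ.≃ U′
      U≃ = QuP.≃-trans (QP.toℚᵘ-homo-* (½ ℚ.+ a) (+ n ℚ./ 1)) (QuP.*-cong (QP.toℚᵘ-homo-+ ½ a) (toℚᵘ-fromℕ n))

      q-2p≡s : + 1 ℤ.* + q ℤ.+ (ℤ.- + p) ℤ.* + 2 ≡ + s
      q-2p≡s = begin
        + 1 ℤ.* + q ℤ.+ (ℤ.- + p) ℤ.* + 2
          ≡⟨ cong₂ ℤ._+_ (ZP.*-identityˡ (+ q)) (trans (sym (ZP.neg-distribˡ-* (+ p) (+ 2))) (cong ℤ.-_ (sym (ZP.pos-* p 2)))) ⟩
        + q ℤ.- + (p ℕ.* 2)    ≡⟨ ZP.m-n≡m⊖n q (p ℕ.* 2) ⟩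
        q ℤ.⊖ (p ℕ.* 2)        ≡⟨ ZP.⊖-≥ (NP.≤-trans (NP.≤-reflexive 2p≡) (NP.m≤m+n (p ℕ.+ p) s)) ⟩
        + (q ℕ.∸ p ℕ.* 2)      ≡⟨ cong +_ (trans (cong (q ℕ.∸_) 2p≡) (NP.m+n∸m≡n (p ℕ.+ p) s)) ⟩
        + s                    ∎
        where
        open ≡-Reasoning
        2p≡ : p ℕ.* 2 ≡ p ℕ.+ p
        2p≡ = solve 1 (λ p → p :* con 2 := p :+ p) refl p

      lower : s ℕ.* n ℕ.≤ 2 ℕ.* q ℕ.* w → (½ ℚ.- a) ℚ.* (+ n ℚ./ 1) ℚ.≤ (+ w ℚ./ 1)
      lower sn≤ = QP.toℚᵘ-cancel-≤ (QuP.≤-respʳ-≃ (QuP.≃-sym (toℚᵘ-fromℕ w)) (QuP.≤-respˡ-≃ (QuP.≃-sym L≃) (*≤* (begin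
        (+ 1 ℤ.* + q ℤ.+ (ℤ.- + p) ℤ.* + 2) ℤ.* + n ℤ.* + 1
          ≡⟨ trans (ZP.*-identityʳ _) (trans (cong (ℤ._* + n) q-2p≡s) (sym (ZP.pos-* s n))) ⟩
        + (s ℕ.* n)
          ≤⟨ ℤ.+≤+ (NP.≤-trans sn≤ (NP.≤-reflexive (solve 2 (λ q w → con 2 :* q :* w := w :* (con 2 :* q :* con 1)) refl q w))) ⟩
        + (w ℕ.* (2 ℕ.* q ℕ.* 1))
          ≡⟨ ZP.pos-* w (2 ℕ.* q ℕ.* 1) ⟩
        + w ℤ.* + (2 ℕ.* q ℕ.* 1)  ∎))))
        where open ZP.≤-Reasoning

      upper : 2 ℕ.* q ℕ.* w ℕ.≤ (p ℕ.+ p ℕ.+ q) ℕ.* n → (+ w ℚ./ 1) ℚ.≤ (½ ℚ.+ a) ℚ.* (+ n ℚ./ 1)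
      upper ≤n = QP.toℚᵘ-cancel-≤ (QuP.≤-respˡ-≃ (QuP.≃-sym (toℚᵘ-fromℕ w)) (QuP.≤-respʳ-≃ (QuP.≃-sym U≃) (*≤* (begin
        + w ℤ.* + (2 ℕ.* q ℕ.* 1)    ≡⟨ sym (ZP.pos-* w (2 ℕ.* q ℕ.* 1)) ⟩
        + (w ℕ.* (2 ℕ.* q ℕ.* 1))
          ≤⟨ ℤ.+≤+ (NP.≤-trans (NP.≤-reflexive (solve 2 (λ q w → w :* (con 2 :* q :* con 1) := con 2 :* q :* w) refl q w))
                     (NP.≤-trans ≤n (NP.≤-reflexive (solve 3 (λ p q n → (p :+ p :+ q) :* n := (q :+ p :* con 2) :* n) refl p q n)))) ⟩
        + ((q ℕ.+ p ℕ.* 2) ℕ.* n)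
          ≡⟨ sym (trans (ZP.*-identityʳ _) (trans (cong (ℤ._* + n) (cong₂ ℤ._+_ (ZP.*-identityˡ (+ q)) (sym (ZP.pos-* p 2))))
                   (trans (cong (ℤ._* + n) (sym (ZP.pos-+ q (p ℕ.* 2)))) (sym (ZP.pos-* (q ℕ.+ p ℕ.* 2) n))))) ⟩
        (+ 1 ℤ.* + q ℤ.+ + p ℤ.* + 2) ℤ.* + n ℤ.* + 1  ∎))))
        where open ZP.≤-Reasoning

open import Level using (Level)
open import Data.Nat as ℕ using (ℕ; _≤_; _∸_; suc; zero)
import Data.Nat.Properties as NP
open import Data.Fin using (Fin)
open import Data.Vec using (Vec)
open import Data.Bool using (Bool; true; false; not; _∧_; if_then_else_) renaming (T to True)
open import Data.List using (List; length)
open import Data.List.Membership.Propositional using (_∉_)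
open import Data.Product using (Σ; _×_; _,_; proj₁; proj₂)
open import Data.Sum using (_⊎_; inj₁; inj₂)
open import Data.Integer using (+_; +[1+_]; -[1+_])
import Data.Integer as ℤ
open import Data.Rational as ℚ using (ℚ; 0ℚ; ½; _<_; mkℚ)
open import Data.Nat.Coprimality using (Coprime)
open import Relation.Nullary using (¬_)
open import Relation.Binary.PropositionalEquality as P using (_≡_)
open import Data.Empty using (⊥-elim)
open import Data.Nat.Solver using (module +-*-Solver)

module Construction {c ℓ} (K : Field c ℓ) (n : ℕ) (1≤n : 1 ≤ n) (p₀ s′ : ℕ)
                    .(cop : Coprime (suc p₀) (suc (p₀ ℕ.+ suc p₀ ℕ.+ suc s′)))
                    (T M : Matrix K n) where

  open Field K using (_≈_) renaming (refl to ≈-refl)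
  open BinomialTail (suc p₀) (suc s′) n
  open CubeCounting
  open RationalBookkeeping using (pow2le-intro; module Fraction)
  open Fraction p₀ s′ cop using (a; module Window; module Exponent)
  open LinearAlgebra.Duality K n using (rank-perturbation)

  central⇒Central : ∀ u → True (central u) → Central n a u
  central⇒Central u cu = lower (proj₁ (central-sound u cu)) , upper (proj₂ (central-sound u cu))
    where open Window n (weight u)

  M′ : Matrix K n
  M′ u v = if central u ∧ central v then M u v else T u v

  agreement : ∀ u v → (¬ Central n a u ⊎ ¬ Central n a v ⊎ M u v ≈ T u v) → M′ u v ≈ T u v
  agreement u v h with central u in eu | central v in ev | h
  ... | false | _     | _                = ≈-refl
  ... | true  | false | _                = ≈-refl
  ... | true  | true  | inj₁ ¬Cu         = ⊥-elim (¬Cu (central⇒Central u (P.subst True (P.sym eu) _)))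
  ... | true  | true  | inj₂ (inj₁ ¬Cv)  = ⊥-elim (¬Cv (central⇒Central v (P.subst True (P.sym ev) _)))
  ... | true  | true  | inj₂ (inj₂ M≈T) = M≈T

  noncentral : List (Vec Bool n)
  noncentral = points n (λ u → not (central u))

  central-off-list : ∀ u → u ∉ noncentral → central u ≡ true
  central-off-list u u∉ with central u in eq
  ... | true  = P.refl
  ... | false = ⊥-elim (u∉ (points-complete n _ u (P.subst (λ b → True (not b)) (P.sym eq) _)))

  agrees-off-list : ∀ u v → u ∉ noncentral → v ∉ noncentral → M′ u v ≈ M u v
  agrees-off-list u v u∉ v∉ rewrite central-off-list u u∉ | central-off-list v v∉ = ≈-refl

  open Exponent n using (e; exponent-ratio)

  -- k - r ≤ 2·|noncentral| ≤ 4L ≤ 4n·L and L^E ≤ 2^(E·e), where E = 2q² is the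
  -- denominator of e = n - a²n/2.  Hence (k - r)^E ≤ (4n)^E · 2^(E·e).
  rank-bound : ∀ r → (∀ j ρ → LinIndepRows K M j ρ → j ≤ r) →
               ∀ k ρ → LinIndepRows K M′ k ρ → Pow2Le (k ∸ r) (4 ℕ.* n) e
  rank-bound r maxM k ρ ind = pow2le-intro (k ∸ r) (4 ℕ.* n) e E Pₑ (ℕ.s≤s ℕ.z≤n) exponent-ratio (begin
    (k ∸ r) ℕ.^ E                    ≤⟨ NP.^-monoˡ-≤ E excess ⟩
    (4 ℕ.* L) ℕ.^ E                  ≡⟨ PowerInequalities.^-distribʳ-* 4 L E ⟩
    4 ℕ.^ E ℕ.* L ℕ.^ E              ≤⟨ NP.*-mono-≤ (NP.^-monoˡ-≤ E (NP.*-monoʳ-≤ 4 1≤n)) light-count ⟩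
    (4 ℕ.* n) ℕ.^ E ℕ.* 2 ℕ.^ Pₑ     ∎)
    where
    open NP.≤-Reasoning
    Pₑ : ℕ
    Pₑ = E ℕ.* n ∸ suc p₀ ℕ.* suc p₀ ℕ.* n
    N : ℕ
    N = length noncentral
    N≤2L : N ≤ L ℕ.+ L
    N≤2L = NP.≤-trans (NP.≤-reflexive (length-points n _)) noncentral-count
    excess : k ∸ r ≤ 4 ℕ.* L
    excess = NP.≤-trans (NP.m≤n+o⇒m∸n≤o k r (rank-perturbation M M′ noncentral agrees-off-list r maxM k ρ ind))
               (NP.≤-trans (NP.+-mono-≤ N≤2L N≤2L) (NP.≤-reflexive (solve 1 (λ L → L :+ L :+ (L :+ L) := con 4 :* L) P.refl L)))
      where open +-*-Solver

corollary3p1 : {ℓ₁ ℓ₂ : Level} →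
    Σ ℚ λ κ → (0ℚ < κ) ×
      ((K : Field ℓ₁ ℓ₂) → (n : ℕ) → 1 ≤ n → (a : ℚ) → 0ℚ < a → a < ½ →
       (T M : Matrix K n) → (r : ℕ) → HasRank K M r →
       Σ (Matrix K n) λ M′ →
         ((k : ℕ) (ρ : Fin k → Vec Bool n) → LinIndepRows K M′ k ρ →
            Pow2Le (k ∸ r) (4 ℕ.* n) ((+ n ℚ./ 1) ℚ.- κ ℚ.* a ℚ.* a ℚ.* (+ n ℚ./ 1))) ×
         ((u v : Vec Bool n) →
            (¬ Central n a u ⊎ ¬ Central n a v ⊎ Field._≈_ K (M u v) (T u v)) →
            Field._≈_ K (M′ u v) (T u v)))
corollary3p1 {ℓ₁} {ℓ₂} = ½ , RationalBookkeeping.0<½ , construction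
  where
  construction : (K : Field ℓ₁ ℓ₂) → (n : ℕ) → 1 ≤ n → (a : ℚ) → 0ℚ < a → a < ½ →
    (T M : Matrix K n) → (r : ℕ) → HasRank K M r →
    Σ (Matrix K n) λ M′ →
      ((k : ℕ) (ρ : Fin k → Vec Bool n) → LinIndepRows K M′ k ρ →
         Pow2Le (k ∸ r) (4 ℕ.* n) ((+ n ℚ./ 1) ℚ.- ½ ℚ.* a ℚ.* a ℚ.* (+ n ℚ./ 1))) ×
      ((u v : Vec Bool n) →
         (¬ Central n a u ⊎ ¬ Central n a v ⊎ Field._≈_ K (M u v) (T u v)) → Field._≈_ K (M′ u v) (T u v))
  construction K n 1≤n (mkℚ (+ zero) _ _) (ℚ.*<* (ℤ.+<+ ())) _
  construction K n 1≤n (mkℚ -[1+ _ ] _ _) (ℚ.*<* ()) _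
  construction K n 1≤n (mkℚ +[1+ p₀ ] d cop) _ a<½ T M r (_ , maxM)
    with RationalBookkeeping.window-split p₀ d cop a<½
  ... | s′ , P.refl = M′ , rank-bound r maxM , agreement
    where open Construction K n 1≤n p₀ s′ cop T M
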